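{- There is an absolute constant $C>0$ such that the following holds. Let $N$ be even, let $J\subseteq\{3,4,5,\dots\}$, and let nonnegative integers $n_j$, $j\in J$, satisfy $\sum_{j\in J} j\,n_j=N$. Let $\alpha$ be uniform on $\mathcal{C}_J$ and, independently, $\beta$ uniform on $\mathcal{C}_2$, and let $X_N$ be the number of orbits on $[N]$ of the subgroup of $S_N$ generated by $\alpha$ and $\beta$ (the number of connected components of the random surface). Then $$\mathrm{P}(X_N=1)\ge 1-CN^{ -1}.$$
   Context: $\mathcal{C}_J$ is the conjugacy class of $S_N$ of permutations of $[N]$ with exactly $n_j$ cycles of length $j$ for each $j\in J$ and no other cycles; $\mathcal{C}_2$ is the class of fixed-point-free involutions of $[N]$. The random surface is obtained from $n=\sum_j n_j$ oriented polygons ($n_j$ with $j$ sides, all $N$ sides labeled by $[N]$, $\alpha$ sending each side to the next side of its polygon) by gluing sides in pairs according to $\beta$. -}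

module Defs where

open import Data.Nat using (ℕ; zero; suc; _+_; _*_; _<_; _≤_)
open import Data.Nat as ℕ using ()
open import Data.Bool using (Bool; true; false; _∧_; _∨_; not; if_then_else_)
open import Data.Fin using (Fin; toℕ)
import Data.Fin as Fin
open import Data.Vec using (Vec; []; _∷_; lookup)
open import Data.List using (List; []; _∷_; map; concatMap; filter; length; allFin; upTo; cartesianProduct)
import Data.List as List
open import Data.Product using (_×_; _,_; proj₁; proj₂)
open import Relation.Nullary.Decidable using (⌊_⌋)
open import Function using (_∘_)
import Data.Bool.ListAction as BL
open import Data.Nat.ListAction using (sum)

allVecs : (N k : ℕ) → List (Vec (Fin N) k)
allVecs N zero    = [] ∷ []
allVecs N (suc k) = concatMap (λ x → map (x ∷_) (allVecs N k)) (allFin N)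

allMaps : (N : ℕ) → List (Fin N → Fin N)
allMaps N = map lookup (allVecs N N)

_=ᶠ_ : {N : ℕ} → Fin N → Fin N → Bool
x =ᶠ y = ⌊ x Fin.≟ y ⌋

_=ⁿ_ : ℕ → ℕ → Bool
m =ⁿ n = ⌊ m ℕ.≟ n ⌋

allB : {N : ℕ} → (Fin N → Bool) → Bool
allB {N} p = BL.all p (allFin N)

countFin : {N : ℕ} → (Fin N → Bool) → ℕ
countFin {N} p = length (filter (λ x → p x Data.Bool.≟ true) (allFin N))

-- f is a permutation of [N] (injective, hence bijective)
isPerm : {N : ℕ} → (Fin N → Fin N) → Bool
isPerm f = allB (λ x → allB (λ y → not (f x =ᶠ f y) ∨ (x =ᶠ y)))

iter : {N : ℕ} → (Fin N → Fin N) → ℕ → Fin N → Fin N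
iter f zero    x = x
iter f (suc k) x = f (iter f k x)

-- length of the cycle of f through x: the least k with 1 ≤ k ≤ N and f^k x = x
-- (for a permutation of [N] such a k always exists; 0 is returned otherwise)
cycleLen : {N : ℕ} → (Fin N → Fin N) → Fin N → ℕ
cycleLen {N} f x = go (List.map suc (upTo N))
  where
  go : List ℕ → ℕ
  go []       = 0
  go (k ∷ ks) = if iter f k x =ᶠ x then k else go ks

-- α ∈ 𝒞_J : α is a permutation of [N] whose cycle through every point has a
-- length j with n j ≥ 1, and for each length j (1 ≤ j ≤ N) the number of points
-- lying on cycles of length j is j * n j (i.e. there are exactly n j cycles of length j).
inClassJ : (N : ℕ) → (ℕ → ℕ) → (Fin N → Fin N) → Bool
inClassJ N n α =
  isPerm α
  ∧ allB (λ x → ⌊ 1 ℕ.≤? n (cycleLen α x) ⌋)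
  ∧ BL.all (λ j → countFin (λ x → cycleLen α x =ⁿ j) =ⁿ (j * n j)) (List.map suc (upTo N))

inClass2 : (N : ℕ) → (Fin N → Fin N) → Bool
inClass2 N β = isPerm β ∧ allB (λ x → (β (β x) =ᶠ x) ∧ not (β x =ᶠ x))

reach : {N : ℕ} → (Fin N → Fin N) → (Fin N → Fin N) → ℕ → Fin N → Fin N → Bool
reach α β zero    x y = x =ᶠ y
reach {N} α β (suc k) x y =
  reach α β k x y ∨ BL.any (λ z → reach α β k x z ∧ ((α z =ᶠ y) ∨ (β z =ᶠ y))) (allFin N)

-- y lies in the orbit of x under ⟨α, β⟩ (for permutations of a finite set,
-- forward reachability in ≤ N steps is exactly the orbit relation)
sameOrbit : {N : ℕ} → (Fin N → Fin N) → (Fin N → Fin N) → Fin N → Fin N → Bool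
sameOrbit {N} α β = reach α β N

-- number of orbits of ⟨α, β⟩ on [N] = number of points that are the least
-- element of their orbit
numOrbits : (N : ℕ) → (Fin N → Fin N) → (Fin N → Fin N) → ℕ
numOrbits N α β = countFin (λ x → allB (λ y → not (sameOrbit α β x y) ∨ ⌊ toℕ x ℕ.≤? toℕ y ⌋))

sizeClassJ : (N : ℕ) → (ℕ → ℕ) → ℕ
sizeClassJ N n = length (filter (λ α → inClassJ N n α Data.Bool.≟ true) (allMaps N))

sizeClass2 : ℕ → ℕ
sizeClass2 N = length (filter (λ β → inClass2 N β Data.Bool.≟ true) (allMaps N))

badPairs : (N : ℕ) → (ℕ → ℕ) → ℕ
badPairs N n =
  length (filter (λ p → (inClassJ N n (proj₁ p) ∧ inClass2 N (proj₂ p)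
                          ∧ not (numOrbits N (proj₁ p) (proj₂ p) =ⁿ 1)) Data.Bool.≟ true)
                 (cartesianProduct (allMaps N) (allMaps N)))

weightSum : ℕ → (ℕ → ℕ) → ℕ
weightSum N n = sum (List.map (λ j → j * n j) (List.map suc (upTo N)))

{-# OPTIONS --safe #-}
-- Fix α ∈ 𝒞_J. Its cycles have length at least 3, so it has K ≤ N/3 of them. If ⟨α, β⟩ has
-- several orbits, then an orbit or its complement is a nonempty union T of t cycles of α with
-- 3t ≤ |T| ≤ N/2 that β preserves. Given T with |T| = m, the fixed-point-free involutions
-- preserving T number (m - 1)!! (N - m - 1)!! out of (N - 1)!! (pairing off one point at a
-- time). A union bound over the sets of t cycles bounds the fraction of bad β by
-- Σₜ C(K, t) max{(m - 1)!! (N - m - 1)!! : 3t ≤ m ≤ N/2} / (N - 1)!!. The terms t = 1, 2 are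
-- O(1/N), the terms t = 3, 4 are O(1/N²), and from t = 3 on every term is at most the one two
-- places before it; as there are at most N terms, the sum is O(1/N).
module Submission where

open import Defs
open import Data.Nat using (ℕ; zero; suc; _+_; _*_; _∸_; _^_; _!; _<_; _≤_; z≤n; s≤s; NonZero; >-nonZero)
open import Data.Nat.Properties
open import Data.Nat.Combinatorics using (_C_; k>n⇒nCk≡0; nC1≡n; nCk+nC[k+1]≡[n+1]C[k+1])
open import Data.Nat.DivMod using (_%_; _/_; m≡m%n+[m/n]*n; m%n<n)
open import Data.Nat.Solver using (module +-*-Solver)
open import Data.Bool using (Bool; true; false; _∧_; _∨_; not; if_then_else_)
import Data.Bool as Bool
open import Data.Bool.Properties using (∧-zeroʳ; ∧-identityʳ; ∧-assoc; not-involutive)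
import Data.Bool.ListAction as BL
open import Data.Fin using (Fin; toℕ)
import Data.Fin as Fin
import Data.Fin.Properties as Fin
open import Data.Fin.Permutation.Components using (transpose; transpose-inverse)
open import Data.List using (List; []; _∷_; _++_; map; filter; length; allFin; upTo; cartesianProduct)
import Data.List.Properties as List
import Data.List.Extrema.Nat as Extrema
open import Data.List.Membership.Propositional using (_∈_)
import Data.List.Membership.Propositional.Properties as ∈
open import Data.List.Relation.Unary.Any using (here; there)
import Data.List.Relation.Unary.Any as Any
import Data.List.Relation.Unary.All as All
import Data.List.Relation.Unary.All.Properties as All
open import Data.List.Relation.Unary.AllPairs using ([]; _∷_)
import Data.List.Relation.Unary.AllPairs.Properties as AllPairs
open import Data.List.Relation.Unary.Unique.Propositional using (Unique)
import Data.List.Relation.Unary.Unique.Propositional.Properties as Unique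
open import Data.Vec using (Vec; []; _∷_; lookup; tabulate)
import Data.Vec.Properties as Vec
open import Data.Product using (Σ; _×_; _,_; proj₁; proj₂)
open import Data.Sum using (_⊎_; inj₁; inj₂)
open import Data.Empty using (⊥-elim)
open import Function using (id; _∘_)
open import Relation.Nullary using (¬_; Dec; yes; no)
open import Relation.Nullary.Decidable using (⌊_⌋; dec-true; dec-false)
open import Relation.Binary.PropositionalEquality
  using (_≡_; _≢_; _≗_; refl; sym; trans; cong; cong₂; subst; subst₂; module ≡-Reasoning)
open +-*-Solver using (solve; _:+_; _:*_; _:=_; con)

-- Boolean reflection and counting

∧-true⁻ : ∀ {a b} → a ∧ b ≡ true → a ≡ true × b ≡ true
∧-true⁻ {true} {true} _ = refl , refl

∧-true⁺ : ∀ {a b} → a ≡ true → b ≡ true → a ∧ b ≡ true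
∧-true⁺ refl refl = refl

∨-true⁻ : ∀ {a b} → a ∨ b ≡ true → a ≡ true ⊎ b ≡ true
∨-true⁻ {true}          _ = inj₁ refl
∨-true⁻ {false} {true}  _ = inj₂ refl

∨-trueˡ : ∀ {a b} → a ≡ true → a ∨ b ≡ true
∨-trueˡ refl = refl

∨-trueʳ : ∀ {a b} → b ≡ true → a ∨ b ≡ true
∨-trueʳ {true}  _    = refl
∨-trueʳ {false} refl = refl

not-true⁻ : ∀ {a} → not a ≡ true → a ≡ false
not-true⁻ {false} _ = refl

not-true⁺ : ∀ {a} → a ≡ false → not a ≡ true
not-true⁺ refl = refl

true≢false : ∀ {a} → a ≡ true → a ≢ false
true≢false refl ()

_⇔ᵇ_ : Bool → Bool → Bool
a ⇔ᵇ b = ⌊ a Bool.≟ b ⌋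

⇔ᵇ⇒≡ : ∀ {a b} → (a ⇔ᵇ b) ≡ true → a ≡ b
⇔ᵇ⇒≡ {true}  {true}  _ = refl
⇔ᵇ⇒≡ {false} {false} _ = refl

≡⇒⇔ᵇ : ∀ {a b} → a ≡ b → (a ⇔ᵇ b) ≡ true
≡⇒⇔ᵇ {true}  refl = refl
≡⇒⇔ᵇ {false} refl = refl

not-⇔ᵇ : ∀ a b → (not a ⇔ᵇ not b) ≡ (a ⇔ᵇ b)
not-⇔ᵇ true  true  = refl
not-⇔ᵇ true  false = refl
not-⇔ᵇ false true  = refl
not-⇔ᵇ false false = refl

⇔ᵇ-false⁻ : ∀ {a b} → (b ≡ true → a ≡ true) → (a ⇔ᵇ b) ≡ false → a ≡ true × b ≡ false
⇔ᵇ-false⁻ {true}  {false} _   _ = refl , refl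
⇔ᵇ-false⁻ {false} {true}  b⇒a _ = ⊥-elim (true≢false (b⇒a refl) refl)

module _ {N : ℕ} {x y : Fin N} where
  =ᶠ⇒≡ : (x =ᶠ y) ≡ true → x ≡ y
  =ᶠ⇒≡ h with x Fin.≟ y
  ... | yes x≡y = x≡y

  ≡⇒=ᶠ : x ≡ y → (x =ᶠ y) ≡ true
  ≡⇒=ᶠ x≡y with x Fin.≟ y
  ... | yes _   = refl
  ... | no  x≢y = ⊥-elim (x≢y x≡y)

  ≢⇒=ᶠ-false : x ≢ y → (x =ᶠ y) ≡ false
  ≢⇒=ᶠ-false x≢y with x Fin.≟ y
  ... | yes x≡y = ⊥-elim (x≢y x≡y)
  ... | no  _   = refl

  =ᶠ-false⇒≢ : (x =ᶠ y) ≡ false → x ≢ y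
  =ᶠ-false⇒≢ h x≡y = true≢false (≡⇒=ᶠ x≡y) h

=ᶠ-refl : ∀ {N} (x : Fin N) → (x =ᶠ x) ≡ true
=ᶠ-refl x = ≡⇒=ᶠ refl

≡⇒=ⁿ : ∀ {m n} → m ≡ n → (m =ⁿ n) ≡ true
≡⇒=ⁿ {m} {n} m≡n with m Data.Nat.≟ n
... | yes _   = refl
... | no  m≢n = ⊥-elim (m≢n m≡n)

⌊≤?⌋⇒≤ : ∀ {m n} → ⌊ m Data.Nat.≤? n ⌋ ≡ true → m ≤ n
⌊≤?⌋⇒≤ {m} {n} h with m Data.Nat.≤? n
... | yes m≤n = m≤n

≤⇒⌊≤?⌋ : ∀ {m n} → m ≤ n → ⌊ m Data.Nat.≤? n ⌋ ≡ true
≤⇒⌊≤?⌋ {m} {n} m≤n with m Data.Nat.≤? n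
... | yes _   = refl
... | no  m≰n = ⊥-elim (m≰n m≤n)

module _ {a} {A : Set a} (p : A → Bool) where
  all-true⁻ : ∀ {xs} → BL.all p xs ≡ true → ∀ {x} → x ∈ xs → p x ≡ true
  all-true⁻ h (here refl)  = proj₁ (∧-true⁻ h)
  all-true⁻ h (there x∈xs) = all-true⁻ (proj₂ (∧-true⁻ {p _} h)) x∈xs

  all-true⁺ : ∀ xs → (∀ {x} → x ∈ xs → p x ≡ true) → BL.all p xs ≡ true
  all-true⁺ []       h = refl
  all-true⁺ (y ∷ xs) h = ∧-true⁺ (h (here refl)) (all-true⁺ xs (λ x∈xs → h (there x∈xs)))

  any-true⁻ : ∀ {xs} → BL.any p xs ≡ true → Σ A λ x → x ∈ xs × p x ≡ true
  any-true⁻ {y ∷ xs} h with ∨-true⁻ {p y} h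
  ... | inj₁ py = y , here refl , py
  ... | inj₂ h′ with x , x∈xs , px ← any-true⁻ h′ = x , there x∈xs , px

  any-true⁺ : ∀ {xs x} → x ∈ xs → p x ≡ true → BL.any p xs ≡ true
  any-true⁺ (here refl)  px = ∨-trueˡ px
  any-true⁺ {y ∷ _} (there x∈xs) px = ∨-trueʳ {p y} (any-true⁺ x∈xs px)

all-false⁻ : ∀ {a} {A : Set a} (p : A → Bool) {xs} → BL.all p xs ≡ false → Σ A λ x → x ∈ xs × p x ≡ false
all-false⁻ p {x ∷ xs} h with p x in px
... | false = x , here refl , px
... | true with y , y∈xs , py ← all-false⁻ p h = y , there y∈xs , py

module _ {a} {A : Set a} {p q : A → Bool} (p≗q : ∀ x → p x ≡ q x) where
  all-cong : ∀ xs → BL.all p xs ≡ BL.all q xs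
  all-cong []       = refl
  all-cong (x ∷ xs) = cong₂ _∧_ (p≗q x) (all-cong xs)

  any-cong : ∀ xs → BL.any p xs ≡ BL.any q xs
  any-cong []       = refl
  any-cong (x ∷ xs) = cong₂ _∨_ (p≗q x) (any-cong xs)

∈-allFin : ∀ {N} (x : Fin N) → x ∈ allFin N
∈-allFin = ∈.∈-tabulate⁺

module _ {N : ℕ} where
  allB-true⁻ : (p : Fin N → Bool) → allB p ≡ true → ∀ x → p x ≡ true
  allB-true⁻ p h x = all-true⁻ p h (∈-allFin x)

  allB-true⁺ : (p : Fin N → Bool) → (∀ x → p x ≡ true) → allB p ≡ true
  allB-true⁺ p h = all-true⁺ p (allFin N) (λ {x} _ → h x)

  allB-cong : {p q : Fin N → Bool} → (∀ x → p x ≡ q x) → allB p ≡ allB q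
  allB-cong p≗q = all-cong p≗q (allFin N)

indicator : Bool → ℕ
indicator true  = 1
indicator false = 0

indicator-mono : ∀ {a b} → (a ≡ true → b ≡ true) → indicator a ≤ indicator b
indicator-mono {false}     _ = z≤n
indicator-mono {true}  a⇒b rewrite a⇒b refl = ≤-refl

module _ {a} {A : Set a} where
  count : (A → Bool) → List A → ℕ
  count p xs = length (filter (λ x → p x Bool.≟ true) xs)

  count-∷ : ∀ p x xs → count p (x ∷ xs) ≡ indicator (p x) + count p xs
  count-∷ p x xs with p x
  ... | true  = refl
  ... | false = refl

  count-++ : ∀ p xs ys → count p (xs ++ ys) ≡ count p xs + count p ys
  count-++ p []       ys = refl
  count-++ p (x ∷ xs) ys = begin
    count p (x ∷ xs ++ ys)                 ≡⟨ count-∷ p x (xs ++ ys) ⟩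
    indicator (p x) + count p (xs ++ ys)   ≡⟨ cong (indicator (p x) +_) (count-++ p xs ys) ⟩
    indicator (p x) + (count p xs + count p ys) ≡⟨ +-assoc (indicator (p x)) _ _ ⟨
    indicator (p x) + count p xs + count p ys   ≡⟨ cong (_+ count p ys) (count-∷ p x xs) ⟨
    count p (x ∷ xs) + count p ys          ∎
    where open ≡-Reasoning

  count-mono : ∀ p q xs → (∀ {x} → x ∈ xs → p x ≡ true → q x ≡ true) → count p xs ≤ count q xs
  count-mono p q []       h = z≤n
  count-mono p q (x ∷ xs) h rewrite count-∷ p x xs | count-∷ q x xs =
    +-mono-≤ (indicator-mono (h (here refl))) (count-mono p q xs (λ x∈xs → h (there x∈xs)))

  count-cong : ∀ {p q} xs → (∀ {x} → x ∈ xs → p x ≡ q x) → count p xs ≡ count q xs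
  count-cong {p} {q} xs h = ≤-antisym
    (count-mono p q xs (λ x∈xs px → trans (sym (h x∈xs)) px))
    (count-mono q p xs (λ x∈xs qx → trans (h x∈xs) qx))

  count≤length : ∀ p xs → count p xs ≤ length xs
  count≤length p xs = List.length-filter (λ x → p x Bool.≟ true) xs

  count-none : ∀ p xs → (∀ {x} → x ∈ xs → p x ≡ false) → count p xs ≡ 0
  count-none p []       h = refl
  count-none p (x ∷ xs) h rewrite count-∷ p x xs | h (here refl) = count-none p xs (λ x∈xs → h (there x∈xs))

  count+count-not : ∀ p xs → count p xs + count (λ x → not (p x)) xs ≡ length xs
  count+count-not p []       = refl
  count+count-not p (x ∷ xs) rewrite count-∷ p x xs | count-∷ (λ x → not (p x)) x xs with p x
  ... | true  = cong suc (count+count-not p xs)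
  ... | false = trans (+-suc (count p xs) _) (cong suc (count+count-not p xs))

  count-< : ∀ p q xs → (∀ {x} → x ∈ xs → p x ≡ true → q x ≡ true)
          → ∀ {y} → y ∈ xs → q y ≡ true → p y ≡ false → count p xs < count q xs
  count-< p q (x ∷ xs) h (here refl) qy py rewrite count-∷ p x xs | count-∷ q x xs | qy | py =
    s≤s (count-mono p q xs (λ x∈xs → h (there x∈xs)))
  count-< p q (x ∷ xs) h (there y∈xs) qy py rewrite count-∷ p x xs | count-∷ q x xs =
    +-mono-≤-< (indicator-mono (h (here refl))) (count-< p q xs (λ x∈xs → h (there x∈xs)) y∈xs qy py)

  count-pos : ∀ p xs → 0 < count p xs → Σ A λ x → x ∈ xs × p x ≡ true
  count-pos p (x ∷ xs) h with p x in px
  ... | true  = x , here refl , px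
  ... | false with y , y∈xs , py ← count-pos p xs h = y , there y∈xs , py

  ∈⇒count-pos : ∀ p {xs x} → x ∈ xs → p x ≡ true → 0 < count p xs
  ∈⇒count-pos p {x ∷ xs} (here refl) px rewrite count-∷ p x xs | px = s≤s z≤n
  ∈⇒count-pos p {y ∷ xs} (there x∈xs) px rewrite count-∷ p y xs =
    ≤-trans (∈⇒count-pos p x∈xs px) (m≤n+m _ _)

count-map : ∀ {a b} {A : Set a} {B : Set b} (p : B → Bool) (f : A → B) xs →
            count p (map f xs) ≡ count (λ x → p (f x)) xs
count-map p f []       = refl
count-map p f (x ∷ xs) rewrite count-∷ p (f x) (map f xs) | count-∷ (λ x → p (f x)) x xs =
  cong (indicator (p (f x)) +_) (count-map p f xs)

module _ {a} {A : Set a} where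
  sumBy : (A → ℕ) → List A → ℕ
  sumBy f []       = 0
  sumBy f (x ∷ xs) = f x + sumBy f xs

  sumBy-+ : ∀ f g xs → sumBy (λ x → f x + g x) xs ≡ sumBy f xs + sumBy g xs
  sumBy-+ f g []       = refl
  sumBy-+ f g (x ∷ xs) rewrite sumBy-+ f g xs =
    solve 4 (λ a b c d → a :+ b :+ (c :+ d) := a :+ c :+ (b :+ d)) refl (f x) (g x) (sumBy f xs) (sumBy g xs)

  sumBy-mono : ∀ f g xs → (∀ {x} → x ∈ xs → f x ≤ g x) → sumBy f xs ≤ sumBy g xs
  sumBy-mono f g []       h = z≤n
  sumBy-mono f g (x ∷ xs) h = +-mono-≤ (h (here refl)) (sumBy-mono f g xs (λ x∈xs → h (there x∈xs)))

  sumBy-cong : ∀ {f g} xs → (∀ {x} → x ∈ xs → f x ≡ g x) → sumBy f xs ≡ sumBy g xs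
  sumBy-cong {f} {g} xs h = ≤-antisym
    (sumBy-mono f g xs (λ x∈xs → ≤-reflexive (h x∈xs)))
    (sumBy-mono g f xs (λ x∈xs → ≤-reflexive (sym (h x∈xs))))

  ≤-sumBy : ∀ f {xs x} → x ∈ xs → f x ≤ sumBy f xs
  ≤-sumBy f (here refl)  = m≤m+n (f _) _
  ≤-sumBy f {y ∷ _} (there x∈xs) = ≤-trans (≤-sumBy f x∈xs) (m≤n+m _ (f y))

  sumBy-*ʳ : ∀ f c xs → sumBy (λ x → f x * c) xs ≡ sumBy f xs * c
  sumBy-*ʳ f c []       = refl
  sumBy-*ʳ f c (x ∷ xs) rewrite sumBy-*ʳ f c xs = sym (*-distribʳ-+ c (f x) (sumBy f xs))

  sumBy-const : ∀ c xs → sumBy (λ _ → c) xs ≡ length xs * c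
  sumBy-const c []       = refl
  sumBy-const c (x ∷ xs) = cong (c +_) (sumBy-const c xs)

  sumBy-zero : ∀ xs → sumBy (λ _ → 0) xs ≡ 0
  sumBy-zero xs = trans (sumBy-const 0 xs) (*-zeroʳ (length xs))

  sumBy-indicator : ∀ p xs → sumBy (λ x → indicator (p x)) xs ≡ count p xs
  sumBy-indicator p []       = refl
  sumBy-indicator p (x ∷ xs) rewrite count-∷ p x xs | sumBy-indicator p xs = refl

  sumBy-++ : ∀ f xs ys → sumBy f (xs ++ ys) ≡ sumBy f xs + sumBy f ys
  sumBy-++ f []       ys = refl
  sumBy-++ f (x ∷ xs) ys rewrite sumBy-++ f xs ys = sym (+-assoc (f x) _ _)

sumBy-map : ∀ {a b} {A : Set a} {B : Set b} (f : B → ℕ) (g : A → B) xs →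
            sumBy f (map g xs) ≡ sumBy (λ x → f (g x)) xs
sumBy-map f g []       = refl
sumBy-map f g (x ∷ xs) = cong (f (g x) +_) (sumBy-map f g xs)

module _ {a i} {A : Set a} {I : Set i} where
  count-union : ∀ (p : A → Bool) (q : I → A → Bool) is xs →
                (∀ {x} → x ∈ xs → p x ≡ true → Σ I λ i → i ∈ is × q i x ≡ true) →
                count p xs ≤ sumBy (λ i → count (q i) xs) is
  count-union p q is []       h = z≤n
  count-union p q is (x ∷ xs) h = begin
    count p (x ∷ xs)
      ≡⟨ count-∷ p x xs ⟩
    indicator (p x) + count p xs
      ≤⟨ +-mono-≤ hit (count-union p q is xs (λ x∈xs → h (there x∈xs))) ⟩
    sumBy (λ i → indicator (q i x)) is + sumBy (λ i → count (q i) xs) is ≡⟨ sumBy-+ _ _ is ⟨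
    sumBy (λ i → indicator (q i x) + count (q i) xs) is
      ≡⟨ sumBy-cong is (λ _ → count-∷ (q _) x xs) ⟨
    sumBy (λ i → count (q i) (x ∷ xs)) is ∎
    where
    open ≤-Reasoning
    hit : indicator (p x) ≤ sumBy (λ i → indicator (q i x)) is
    hit with p x in px
    ... | false = z≤n
    ... | true with i , i∈is , qix ← h (here refl) px =
      ≤-trans (≤-reflexive (cong indicator (sym qix))) (≤-sumBy (λ i → indicator (q i x)) i∈is)

  sumBy-count-comm : ∀ (q : I → A → Bool) is xs →
                     sumBy (λ i → count (q i) xs) is ≡ sumBy (λ x → sumBy (λ i → indicator (q i x)) is) xs
  sumBy-count-comm q is []       = sumBy-zero is
  sumBy-count-comm q is (x ∷ xs) = begin
    sumBy (λ i → count (q i) (x ∷ xs)) is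
      ≡⟨ sumBy-cong is (λ _ → count-∷ (q _) x xs) ⟩
    sumBy (λ i → indicator (q i x) + count (q i) xs) is
      ≡⟨ sumBy-+ _ _ is ⟩
    sumBy (λ i → indicator (q i x)) is + sumBy (λ i → count (q i) xs) is
      ≡⟨ cong (sumBy (λ i → indicator (q i x)) is +_) (sumBy-count-comm q is xs) ⟩
    sumBy (λ i → indicator (q i x)) is + sumBy (λ x → sumBy (λ i → indicator (q i x)) is) xs ∎
    where open ≡-Reasoning

module _ {a} {A : Set a} where
  unique-⊆⇒length≤ : {xs ys : List A} → Unique xs → (∀ {x} → x ∈ xs → x ∈ ys) → length xs ≤ length ys
  unique-⊆⇒length≤ {[]}     _           _    = z≤n
  unique-⊆⇒length≤ {x ∷ xs} (x∉xs ∷ u) xs⊆ys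
    with ys₁ , ys₂ , refl ← ∈.∈-∃++ (xs⊆ys (here refl)) = begin
    suc (length xs)               ≤⟨ s≤s (unique-⊆⇒length≤ u xs⊆ys₁ys₂) ⟩
    suc (length (ys₁ ++ ys₂))     ≡⟨ cong suc (List.length-++ ys₁) ⟩
    suc (length ys₁ + length ys₂) ≡⟨ +-suc (length ys₁) _ ⟨
    length ys₁ + length (x ∷ ys₂) ≡⟨ List.length-++ ys₁ ⟨
    length (ys₁ ++ x ∷ ys₂)       ∎
    where
    open ≤-Reasoning
    xs⊆ys₁ys₂ : ∀ {z} → z ∈ xs → z ∈ ys₁ ++ ys₂
    xs⊆ys₁ys₂ z∈xs with ∈.∈-++⁻ ys₁ (xs⊆ys (there z∈xs))
    ... | inj₁ z∈ys₁         = ∈.∈-++⁺ˡ z∈ys₁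
    ... | inj₂ (here refl)   = ⊥-elim (All.lookup x∉xs z∈xs refl)
    ... | inj₂ (there z∈ys₂) = ∈.∈-++⁺ʳ ys₁ z∈ys₂

module _ {a b} {A : Set a} {B : Set b} (f : A → B) where
  unique-map⁺ : ∀ {xs} → Unique xs → (∀ {x y} → x ∈ xs → y ∈ xs → f x ≡ f y → x ≡ y) →
                Unique (map f xs)
  unique-map⁺ {[]}     []          _   = []
  unique-map⁺ {x ∷ xs} (x∉xs ∷ u) inj =
    fresh xs x∉xs there ∷ unique-map⁺ u (λ y∈xs z∈xs → inj (there y∈xs) (there z∈xs))
    where
    fresh : ∀ zs → All.All (x ≢_) zs → (∀ {z} → z ∈ zs → z ∈ x ∷ xs) → All.All (f x ≢_) (map f zs)
    fresh []       _              _    = All.[]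
    fresh (z ∷ zs) (x≢z All.∷ ns) zs⊆ =
      (λ e → x≢z (inj (here refl) (zs⊆ (here refl)) e)) All.∷ fresh zs ns (λ z∈zs → zs⊆ (there z∈zs))

module _ {N : ℕ} where
  count-=ᶠ : ∀ {xs} {y : Fin N} → Unique xs → y ∈ xs → count (y =ᶠ_) xs ≡ 1
  count-=ᶠ {x ∷ xs} (x∉xs ∷ _) (here refl) rewrite count-∷ (x =ᶠ_) x xs | =ᶠ-refl x =
    cong suc (count-none (x =ᶠ_) xs (λ z∈xs → ≢⇒=ᶠ-false (All.lookup x∉xs z∈xs)))
  count-=ᶠ {x ∷ xs} {y} (x∉xs ∷ u) (there y∈xs)
    rewrite count-∷ (y =ᶠ_) x xs | ≢⇒=ᶠ-false (λ y≡x → All.lookup x∉xs y∈xs (sym y≡x)) = count-=ᶠ u y∈xs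

  count-by-value : ∀ {a} {A : Set a} (p : A → Bool) (k : A → Fin N) xs →
                   count p xs ≡ sumBy (λ b → count (λ x → p x ∧ (k x =ᶠ b)) xs) (allFin N)
  count-by-value p k xs = begin
    count p xs
      ≡⟨ sumBy-indicator p xs ⟨
    sumBy (λ x → indicator (p x)) xs
      ≡⟨ sumBy-cong xs (λ {x} _ → split x) ⟩
    sumBy (λ x → sumBy (λ b → indicator (p x ∧ (k x =ᶠ b))) (allFin N)) xs
      ≡⟨ sumBy-count-comm (λ b x → p x ∧ (k x =ᶠ b)) (allFin N) xs ⟨
    sumBy (λ b → count (λ x → p x ∧ (k x =ᶠ b)) xs) (allFin N) ∎
    where
    open ≡-Reasoning
    split : ∀ x → indicator (p x) ≡ sumBy (λ b → indicator (p x ∧ (k x =ᶠ b))) (allFin N)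
    split x with p x
    ... | false = sym (sumBy-zero (allFin N))
    ... | true  = sym (trans (sumBy-indicator (k x =ᶠ_) (allFin N))
                             (count-=ᶠ (Unique.allFin⁺ N) (∈-allFin (k x))))

count-cartesianProduct : ∀ {a b} {A : Set a} {B : Set b} (r : A × B → Bool) xs ys →
                         count r (cartesianProduct xs ys) ≡ sumBy (λ x → count (λ y → r (x , y)) ys) xs
count-cartesianProduct r []       ys = refl
count-cartesianProduct r (x ∷ xs) ys = begin
  count r (map (x ,_) ys ++ cartesianProduct xs ys)
    ≡⟨ count-++ r (map (x ,_) ys) _ ⟩
  count r (map (x ,_) ys) + count r (cartesianProduct xs ys)
    ≡⟨ cong₂ _+_ (count-map r (x ,_) ys) (count-cartesianProduct r xs ys) ⟩
  count (λ y → r (x , y)) ys + sumBy (λ x → count (λ y → r (x , y)) ys) xs ∎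
  where open ≡-Reasoning

module _ {N : ℕ} where
  allVecs-complete : ∀ k (v : Vec (Fin N) k) → v ∈ allVecs N k
  allVecs-complete zero    []      = here refl
  allVecs-complete (suc k) (x ∷ v) =
    ∈.∈-concatMap⁺ (λ y → map (y ∷_) (allVecs N k))
      (Any.map (λ { refl → ∈.∈-map⁺ (x ∷_) (allVecs-complete k v) }) (∈-allFin x))

  allVecs-unique : ∀ k → Unique (allVecs N k)
  allVecs-unique zero    = All.[] ∷ []
  allVecs-unique (suc k) =
    Unique.concat⁺ (All.map⁺ (All.tabulate⁺ (λ x → Unique.map⁺ ∷-injectiveʳ (allVecs-unique k))))
                   (AllPairs.map⁺ (AllPairs.tabulate⁺ disjoint))
    where
    ∷-injectiveʳ : ∀ {x : Fin N} {v w : Vec (Fin N) k} → x ∷ v ≡ x ∷ w → v ≡ w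
    ∷-injectiveʳ refl = refl
    disjoint : ∀ {i j : Fin N} → i ≢ j →
               ∀ {v} → ¬ (v ∈ map (i ∷_) (allVecs N k) × v ∈ map (j ∷_) (allVecs N k))
    disjoint i≢j (v∈i , v∈j) with ∈.∈-map⁻ _ v∈i | ∈.∈-map⁻ _ v∈j
    ... | _ , _ , refl | _ , _ , refl = i≢j refl

Map : ℕ → Set
Map N = Fin N → Fin N

module _ {N : ℕ} where
  countMaps : (Map N → Bool) → ℕ
  countMaps P = count P (allMaps N)

  Extensional : (Map N → Bool) → Set
  Extensional P = ∀ {f g} → f ≗ g → P f ≡ P g

  InjectiveOn : (Map N → Bool) → (Map N → Map N) → Set
  InjectiveOn P h = ∀ {f g} → P f ≡ true → P g ≡ true → h f ≗ h g → f ≗ g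

  -- Maps are enumerated through their lookup tables, on which ≗ becomes ≡.
  countMaps-≤ : ∀ P Q (h : Map N → Map N) → Extensional Q → InjectiveOn P h →
                (∀ {f} → P f ≡ true → Q (h f) ≡ true) → countMaps P ≤ countMaps Q
  countMaps-≤ P Q h extQ inj P⇒Q = begin
    countMaps P                              ≡⟨ count-map P lookup tables ⟩
    count (λ v → P (lookup v)) tables        ≡⟨ List.length-map hᵗ Ptables ⟨
    length (map hᵗ Ptables)                  ≤⟨ unique-⊆⇒length≤ unique-image image⊆ ⟩
    count (λ v → Q (lookup v)) tables        ≡⟨ count-map Q lookup tables ⟨
    countMaps Q                              ∎
    where
    open ≤-Reasoning
    tables = allVecs N N
    Ptables = filter (λ v → P (lookup v) Bool.≟ true) tables
    hᵗ : Vec (Fin N) N → Vec (Fin N) N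
    hᵗ v = tabulate (h (lookup v))
    P-of : ∀ {v} → v ∈ Ptables → P (lookup v) ≡ true
    P-of v∈ = proj₂ (∈.∈-filter⁻ (λ v → P (lookup v) Bool.≟ true) {xs = tables} v∈)
    hᵗ-injective : ∀ {v w} → v ∈ Ptables → w ∈ Ptables → hᵗ v ≡ hᵗ w → v ≡ w
    hᵗ-injective {v} {w} v∈ w∈ e =
      trans (sym (Vec.tabulate∘lookup v))
            (trans (Vec.tabulate-cong (inj (P-of v∈) (P-of w∈) hv≗hw)) (Vec.tabulate∘lookup w))
      where
      hv≗hw : h (lookup v) ≗ h (lookup w)
      hv≗hw i = trans (sym (Vec.lookup∘tabulate (h (lookup v)) i))
                      (trans (cong (λ z → lookup z i) e) (Vec.lookup∘tabulate (h (lookup w)) i))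
    unique-image : Unique (map hᵗ Ptables)
    unique-image = unique-map⁺ hᵗ (Unique.filter⁺ _ (allVecs-unique N)) hᵗ-injective
    image⊆ : ∀ {u} → u ∈ map hᵗ Ptables → u ∈ filter (λ v → Q (lookup v) Bool.≟ true) tables
    image⊆ u∈ with v , v∈ , refl ← ∈.∈-map⁻ hᵗ u∈ =
      ∈.∈-filter⁺ _ (allVecs-complete N (hᵗ v))
        (trans (extQ (Vec.lookup∘tabulate (h (lookup v)))) (P⇒Q (P-of v∈)))

  countMaps-≡ : ∀ P Q (h k : Map N → Map N) → Extensional P → Extensional Q →
                InjectiveOn P h → InjectiveOn Q k →
                (∀ {f} → P f ≡ true → Q (h f) ≡ true) → (∀ {f} → Q f ≡ true → P (k f) ≡ true) →
                countMaps P ≡ countMaps Q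
  countMaps-≡ P Q h k extP extQ injh injk P⇒Q Q⇒P =
    ≤-antisym (countMaps-≤ P Q h extQ injh P⇒Q) (countMaps-≤ Q P k extP injk Q⇒P)

  countMaps-⇔ : ∀ P Q → Extensional P → Extensional Q →
                (∀ {f} → P f ≡ true → Q f ≡ true) → (∀ {f} → Q f ≡ true → P f ≡ true) →
                countMaps P ≡ countMaps Q
  countMaps-⇔ P Q extP extQ = countMaps-≡ P Q id id extP extQ (λ _ _ e → e) (λ _ _ e → e)

count-split : ∀ {a} {A : Set a} (p r : A → Bool) xs →
              count (λ x → p x ∧ r x) xs + count (λ x → p x ∧ not (r x)) xs ≡ count p xs
count-split p r []       = refl
count-split p r (x ∷ xs)
  rewrite count-∷ (λ x → p x ∧ r x) x xs | count-∷ (λ x → p x ∧ not (r x)) x xs | count-∷ p x xs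
  with p x | r x
... | false | _     = count-split p r xs
... | true  | true  = cong suc (count-split p r xs)
... | true  | false = trans (+-suc _ _) (cong suc (count-split p r xs))

module _ {N : ℕ} where
  countFin-cong : {p q : Fin N → Bool} → (∀ x → p x ≡ q x) → countFin p ≡ countFin q
  countFin-cong p≗q = count-cong (allFin N) (λ {x} _ → p≗q x)

  countFin≤N : (p : Fin N → Bool) → countFin p ≤ N
  countFin≤N p = ≤-trans (count≤length p (allFin N)) (≤-reflexive (List.length-tabulate id))

  countFin+countFin-not : (p : Fin N → Bool) → countFin p + countFin (λ x → not (p x)) ≡ N
  countFin+countFin-not p = trans (count+count-not p (allFin N)) (List.length-tabulate id)

  countFin-pos : (p : Fin N → Bool) → 0 < countFin p → Σ (Fin N) λ x → p x ≡ true
  countFin-pos p h with x , _ , px ← count-pos p (allFin N) h = x , px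

  countFin-none : (p : Fin N → Bool) → countFin p ≡ 0 → ∀ x → p x ≡ false
  countFin-none p h x with p x in px
  ... | false = refl
  ... | true  = ⊥-elim (<⇒≢ (∈⇒count-pos p (∈-allFin x) px) (sym h))

  countFin-remove : (p : Fin N → Bool) {a : Fin N} → p a ≡ true →
                    countFin (λ x → p x ∧ not (x =ᶠ a)) + 1 ≡ countFin p
  countFin-remove p {a} pa = begin
    countFin (λ x → p x ∧ not (x =ᶠ a)) + 1
      ≡⟨ +-comm _ 1 ⟩
    1 + countFin (λ x → p x ∧ not (x =ᶠ a))
      ≡⟨ cong (_+ countFin (λ x → p x ∧ not (x =ᶠ a))) only-a ⟨
    countFin (λ x → p x ∧ (x =ᶠ a)) + countFin (λ x → p x ∧ not (x =ᶠ a))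
      ≡⟨ count-split p (_=ᶠ a) (allFin N) ⟩
    countFin p ∎
    where
    open ≡-Reasoning
    at-a : ∀ x → (p x ∧ (x =ᶠ a)) ≡ (a =ᶠ x)
    at-a x with x Fin.≟ a
    ... | yes refl rewrite pa | =ᶠ-refl x = refl
    ... | no x≢a   rewrite ≢⇒=ᶠ-false (λ a≡x → x≢a (sym a≡x)) = ∧-zeroʳ (p x)
    only-a : countFin (λ x → p x ∧ (x =ᶠ a)) ≡ 1
    only-a = trans (countFin-cong at-a) (count-=ᶠ (Unique.allFin⁺ N) (∈-allFin a))

-- Fixed-point-free involutions preserving a set

-- The number of fixed-point-free involutions of an m-element set: (m - 1)!! for even m, 0 for odd m.
matchings : ℕ → ℕ
matchings zero          = 1
matchings (suc zero)    = 0
matchings (suc (suc m)) = suc m * matchings m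

module _ {N : ℕ} (i j : Fin N) where
  transpose-at-i : transpose i j i ≡ j
  transpose-at-i rewrite dec-true (i Fin.≟ i) refl = refl

  transpose-at-j : transpose i j j ≡ i
  transpose-at-j with j Fin.≟ i
  ... | yes j≡i = j≡i
  ... | no  _   rewrite dec-true (j Fin.≟ j) refl = refl

  transpose-other : ∀ {k} → k ≢ i → k ≢ j → transpose i j k ≡ k
  transpose-other k≢i k≢j rewrite dec-false (_ Fin.≟ i) k≢i | dec-false (_ Fin.≟ j) k≢j = refl

∘transpose-injective : ∀ {N} (i j : Fin N) {f g : Map N} → f ∘ transpose i j ≗ g ∘ transpose i j → f ≗ g
∘transpose-injective i j {f} {g} e x =
  trans (cong f (sym (transpose-inverse i j))) (trans (e (transpose j i x)) (cong g (transpose-inverse i j)))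

module _ {N : ℕ} where
  record Matched (U S : Fin N → Bool) (β : Map N) (x : Fin N) : Set where
    field
      moves       : β x ≢ x
      involutive  : β (β x) ≡ x
      stays       : U (β x) ≡ true
      keepsColour : S (β x) ≡ S x

  record ColouredMatching (U S : Fin N → Bool) (β : Map N) : Set where
    field
      matched : ∀ {x} → U x ≡ true → Matched U S β x
      fixed   : ∀ {x} → U x ≡ false → β x ≡ x

  matchedᵇ : (U S : Fin N → Bool) (x y z : Fin N) → Bool
  matchedᵇ U S x y z = if U x then not (y =ᶠ x) ∧ (z =ᶠ x) ∧ U y ∧ (S y ⇔ᵇ S x) else (y =ᶠ x)

  isColouredMatching : (U S : Fin N → Bool) → Map N → Bool
  isColouredMatching U S β = allB (λ x → matchedᵇ U S x (β x) (β (β x)))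

  isColouredMatching-ext : ∀ U S → Extensional (isColouredMatching U S)
  isColouredMatching-ext U S {f} {g} f≗g =
    allB-cong (λ x → cong₂ (matchedᵇ U S x) (f≗g x) (trans (f≗g (f x)) (cong g (f≗g x))))

  isColouredMatching⁻ : ∀ {U S β} → isColouredMatching U S β ≡ true → ColouredMatching U S β
  isColouredMatching⁻ {U} {S} {β} h = record { matched = matched ; fixed = fixed }
    where
    at : ∀ x → matchedᵇ U S x (β x) (β (β x)) ≡ true
    at = allB-true⁻ _ h
    matched : ∀ {x} → U x ≡ true → Matched U S β x
    matched {x} ux with U x | at x
    ... | true | hx with ∧-true⁻ hx
    ... | moves , hx₁ with ∧-true⁻ hx₁
    ... | invol , hx₂ with ∧-true⁻ hx₂
    ... | stays , colour = record
      { moves = =ᶠ-false⇒≢ (not-true⁻ moves) ; involutive = =ᶠ⇒≡ invol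
      ; stays = stays ; keepsColour = ⇔ᵇ⇒≡ colour }
    fixed : ∀ {x} → U x ≡ false → β x ≡ x
    fixed {x} ux with U x | at x
    ... | false | hx = =ᶠ⇒≡ hx

  isColouredMatching⁺ : ∀ {U S β} → ColouredMatching U S β → isColouredMatching U S β ≡ true
  isColouredMatching⁺ {U} {S} {β} cm = allB-true⁺ _ at
    where
    open ColouredMatching cm
    at : ∀ x → matchedᵇ U S x (β x) (β (β x)) ≡ true
    at x with U x in ux
    ... | false = ≡⇒=ᶠ (fixed ux)
    ... | true  = ∧-true⁺ (not-true⁺ (≢⇒=ᶠ-false moves))
                 (∧-true⁺ (≡⇒=ᶠ involutive) (∧-true⁺ stays (≡⇒⇔ᵇ keepsColour)))
      where open Matched (matched ux)

  remove₂ : (Fin N → Bool) → Fin N → Fin N → Fin N → Bool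
  remove₂ U a b x = U x ∧ not (x =ᶠ a) ∧ not (x =ᶠ b)

  module _ (U : Fin N → Bool) (a b : Fin N) where
    remove₂-a : remove₂ U a b a ≡ false
    remove₂-a rewrite =ᶠ-refl a = ∧-zeroʳ (U a)

    remove₂-b : remove₂ U a b b ≡ false
    remove₂-b rewrite =ᶠ-refl b = trans (cong (U b ∧_) (∧-zeroʳ (not (b =ᶠ a)))) (∧-zeroʳ (U b))

    remove₂-other : ∀ {x} → x ≢ a → x ≢ b → remove₂ U a b x ≡ U x
    remove₂-other {x} x≢a x≢b rewrite ≢⇒=ᶠ-false x≢a | ≢⇒=ᶠ-false x≢b = ∧-identityʳ (U x)

    remove₂-true⁻ : ∀ {x} → remove₂ U a b x ≡ true → U x ≡ true × x ≢ a × x ≢ b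
    remove₂-true⁻ {x} h with ∧-true⁻ {U x} h
    ... | ux , h′ with ∧-true⁻ {not (x =ᶠ a)} h′
    ... | x≢a , x≢b = ux , =ᶠ-false⇒≢ (not-true⁻ x≢a) , =ᶠ-false⇒≢ (not-true⁻ x≢b)

  -- Matchings sending a to b correspond, through the transposition of a and b,
  -- to matchings of U without a and b.
  module _ (U S : Fin N → Bool) {a b : Fin N} (Ua : U a ≡ true) (Ub : U b ≡ true)
           (a≢b : a ≢ b) (Sb≡Sa : S b ≡ S a) where
    private
      U′ = remove₂ U a b

    matching-remove₂ : ∀ {β} → ColouredMatching U S β → β a ≡ b →
                       ColouredMatching U′ S (β ∘ transpose a b)
    matching-remove₂ {β} cm βa≡b = record { matched = matched′ ; fixed = fixed′ }
      where
      open ColouredMatching cm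
      β′ = β ∘ transpose a b
      βb≡a : β b ≡ a
      βb≡a = trans (cong β (sym βa≡b)) (Matched.involutive (matched Ua))
      β′-other : ∀ {x} → x ≢ a → x ≢ b → β′ x ≡ β x
      β′-other x≢a x≢b = cong β (transpose-other a b x≢a x≢b)
      matched′ : ∀ {x} → U′ x ≡ true → Matched U′ S β′ x
      matched′ {x} h with ux , x≢a , x≢b ← remove₂-true⁻ U a b h = record
        { moves       = λ e → moves (trans (sym β′x) e)
        ; involutive  = trans (cong β′ β′x) (trans (β′-other βx≢a βx≢b) involutive)
        ; stays       = trans (cong U′ β′x) (trans (remove₂-other U a b βx≢a βx≢b) stays)
        ; keepsColour = trans (cong S β′x) keepsColour }
        where
        open Matched (matched ux)
        β′x = β′-other x≢a x≢b
        βx≢a : β x ≢ a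
        βx≢a e = x≢b (trans (sym involutive) (trans (cong β e) βa≡b))
        βx≢b : β x ≢ b
        βx≢b e = x≢a (trans (sym involutive) (trans (cong β e) βb≡a))
      fixed′ : ∀ {x} → U′ x ≡ false → β′ x ≡ x
      fixed′ {x} h = by-cases (x Fin.≟ a) (x Fin.≟ b)
        where
        by-cases : Dec (x ≡ a) → Dec (x ≡ b) → β′ x ≡ x
        by-cases (yes refl) _          = trans (cong β (transpose-at-i a b)) βb≡a
        by-cases (no _)     (yes refl) = trans (cong β (transpose-at-j a b)) βa≡b
        by-cases (no x≢a)   (no x≢b)   =
          trans (β′-other x≢a x≢b) (fixed (trans (sym (remove₂-other U a b x≢a x≢b)) h))

    matching-insert₂ : ∀ {γ} → ColouredMatching U′ S γ →
                       ColouredMatching U S (γ ∘ transpose b a) × (γ ∘ transpose b a) a ≡ b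
    matching-insert₂ {γ} cm = record { matched = matched′ ; fixed = fixed′ } , γ′a≡b
      where
      open ColouredMatching cm
      γ′ = γ ∘ transpose b a
      γ′a≡b : γ′ a ≡ b
      γ′a≡b = trans (cong γ (transpose-at-j b a)) (fixed (remove₂-b U a b))
      γ′b≡a : γ′ b ≡ a
      γ′b≡a = trans (cong γ (transpose-at-i b a)) (fixed (remove₂-a U a b))
      γ′-other : ∀ {x} → x ≢ a → x ≢ b → γ′ x ≡ γ x
      γ′-other x≢a x≢b = cong γ (transpose-other b a x≢b x≢a)
      matched′ : ∀ {x} → U x ≡ true → Matched U S γ′ x
      matched′ {x} ux = by-cases (x Fin.≟ a) (x Fin.≟ b)
        where
        by-cases : Dec (x ≡ a) → Dec (x ≡ b) → Matched U S γ′ x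
        by-cases (yes refl) _ = record
          { moves = λ e → a≢b (trans (sym e) γ′a≡b) ; involutive = trans (cong γ′ γ′a≡b) γ′b≡a
          ; stays = trans (cong U γ′a≡b) Ub ; keepsColour = trans (cong S γ′a≡b) Sb≡Sa }
        by-cases (no _) (yes refl) = record
          { moves = λ e → a≢b (trans (sym γ′b≡a) e) ; involutive = trans (cong γ′ γ′b≡a) γ′a≡b
          ; stays = trans (cong U γ′b≡a) Ua ; keepsColour = trans (cong S γ′b≡a) (sym Sb≡Sa) }
        by-cases (no x≢a) (no x≢b) = transport (matched (trans (remove₂-other U a b x≢a x≢b) ux))
          where
          γ′x = γ′-other x≢a x≢b
          transport : Matched U′ S γ x → Matched U S γ′ x
          transport m with uγx , γx≢a , γx≢b ← remove₂-true⁻ U a b (Matched.stays m) = record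
            { moves       = λ e → moves (trans (sym γ′x) e)
            ; involutive  = trans (cong γ′ γ′x) (trans (γ′-other γx≢a γx≢b) involutive)
            ; stays       = trans (cong U γ′x) uγx
            ; keepsColour = trans (cong S γ′x) keepsColour }
            where open Matched m
      fixed′ : ∀ {x} → U x ≡ false → γ′ x ≡ x
      fixed′ {x} ux = trans (γ′-other x≢a x≢b) (fixed (trans (remove₂-other U a b x≢a x≢b) ux))
        where
        x≢a : x ≢ a
        x≢a refl = true≢false Ua ux
        x≢b : x ≢ b
        x≢b refl = true≢false Ub ux

    countMaps-matching-through : countMaps (λ β → isColouredMatching U S β ∧ (β a =ᶠ b))
                               ≡ countMaps (isColouredMatching U′ S)
    countMaps-matching-through = countMaps-≡ _ _ (_∘ transpose a b) (_∘ transpose b a)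
      (λ f≗g → cong₂ _∧_ (isColouredMatching-ext U S f≗g) (cong (_=ᶠ b) (f≗g a)))
      (isColouredMatching-ext U′ S)
      (λ _ _ → ∘transpose-injective a b) (λ _ _ → ∘transpose-injective b a)
      (λ h → let cm , βa = ∧-true⁻ h in
             isColouredMatching⁺ (matching-remove₂ (isColouredMatching⁻ cm) (=ᶠ⇒≡ βa)))
      (λ h → let cm , γ′a = matching-insert₂ (isColouredMatching⁻ h) in
             ∧-true⁺ (isColouredMatching⁺ cm) (≡⇒=ᶠ γ′a))

_∩ᵇ_ : ∀ {a} {A : Set a} → (A → Bool) → (A → Bool) → A → Bool
(U ∩ᵇ S) x = U x ∧ S x

∁ᵇ : ∀ {a} {A : Set a} → (A → Bool) → A → Bool
∁ᵇ S x = not (S x)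

matchings-suc : ∀ m → matchings (suc m) ≡ m * matchings (m ∸ 1)
matchings-suc zero    = refl
matchings-suc (suc m) = refl

module _ {N : ℕ} where
  identityCount : ℕ
  identityCount = countMaps {N} (λ β → allB (λ x → β x =ᶠ x))

  MatchingFormula : (U S : Fin N → Bool) → Set
  MatchingFormula U S = countMaps (isColouredMatching U S)
                      ≡ matchings (countFin (U ∩ᵇ S)) * matchings (countFin (U ∩ᵇ ∁ᵇ S)) * identityCount

  matchingFormula-∅ : ∀ {U} S → countFin U ≡ 0 → MatchingFormula U S
  matchingFormula-∅ {U} S U≡∅ = begin
    countMaps (isColouredMatching U S)
      ≡⟨ countMaps-⇔ (isColouredMatching U S) isId (isColouredMatching-ext U S) ext only-id id-only ⟩
    identityCount
      ≡⟨ +-identityʳ identityCount ⟨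
    1 * 1 * identityCount
      ≡⟨ cong₂ (λ m n → matchings m * matchings n * identityCount) empty∩ empty∩ ⟨
    matchings (countFin (U ∩ᵇ S)) * matchings (countFin (U ∩ᵇ ∁ᵇ S)) * identityCount ∎
    where
    open ≡-Reasoning
    U-false = countFin-none U U≡∅
    isId : Map N → Bool
    isId β = allB (λ x → β x =ᶠ x)
    ext : Extensional isId
    ext f≗g = allB-cong (λ x → cong (_=ᶠ x) (f≗g x))
    only-id : ∀ {β} → isColouredMatching U S β ≡ true → isId β ≡ true
    only-id {β} h = allB-true⁺ (λ x → β x =ᶠ x)
      (λ x → ≡⇒=ᶠ (ColouredMatching.fixed (isColouredMatching⁻ {U = U} {S = S} h) (U-false x)))
    id-only : ∀ {β} → isId β ≡ true → isColouredMatching U S β ≡ true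
    id-only {β} h = isColouredMatching⁺ (record
      { matched = λ {x} ux → ⊥-elim (true≢false ux (U-false x))
      ; fixed   = λ {x} _  → =ᶠ⇒≡ (allB-true⁻ (λ x → β x =ᶠ x) h x) })
    empty∩ : ∀ {S′} → countFin (U ∩ᵇ S′) ≡ 0
    empty∩ {S′} = count-none (U ∩ᵇ S′) (allFin N) (λ {x} _ → cong (_∧ S′ x) (U-false x))

  isColouredMatching-∁ : ∀ (U S : Fin N → Bool) β → isColouredMatching U (∁ᵇ S) β ≡ isColouredMatching U S β
  isColouredMatching-∁ U S β = allB-cong at
    where
    at : ∀ x → matchedᵇ U (∁ᵇ S) x (β x) (β (β x)) ≡ matchedᵇ U S x (β x) (β (β x))
    at x with U x
    ... | true  = cong (λ t → not (β x =ᶠ x) ∧ (β (β x) =ᶠ x) ∧ U (β x) ∧ t) (not-⇔ᵇ (S (β x)) (S x))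
    ... | false = refl

  matchingFormula-∁ : ∀ (U S : Fin N → Bool) → MatchingFormula U (∁ᵇ S) → MatchingFormula U S
  matchingFormula-∁ U S formula = begin
    countMaps (isColouredMatching U S)
      ≡⟨ count-cong {p = isColouredMatching U (∁ᵇ S)} (allMaps N) (λ {β} _ → isColouredMatching-∁ U S β) ⟨
    countMaps (isColouredMatching U (∁ᵇ S))
      ≡⟨ formula ⟩
    matchings c∁ * matchings c∁∁ * identityCount ≡⟨ cong (λ c → matchings c∁ * matchings c * identityCount)
                                                        (countFin-cong {p = U ∩ᵇ ∁ᵇ (∁ᵇ S)} (λ x → cong (U x ∧_) (not-involutive (S x)))) ⟩
    matchings c∁ * matchings c * identityCount
      ≡⟨ cong (_* identityCount) (*-comm (matchings c∁) (matchings c)) ⟩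
    matchings c * matchings c∁ * identityCount ∎
    where
    open ≡-Reasoning
    c   = countFin (U ∩ᵇ S)
    c∁  = countFin (U ∩ᵇ ∁ᵇ S)
    c∁∁ = countFin (U ∩ᵇ ∁ᵇ (∁ᵇ S))

  countFin-remove₂ : ∀ (U : Fin N → Bool) {a b} → U a ≡ true → U b ≡ true → a ≢ b →
                     countFin (remove₂ U a b) + 2 ≡ countFin U
  countFin-remove₂ U {a} {b} Ua Ub a≢b = begin
    countFin (remove₂ U a b) + 2
      ≡⟨ +-assoc (countFin (remove₂ U a b)) 1 1 ⟨
    countFin (remove₂ U a b) + 1 + 1
      ≡⟨ cong (λ c → c + 1 + 1) (countFin-cong {p = λ x → (U x ∧ not (x =ᶠ a)) ∧ not (x =ᶠ b)}
                                              (λ x → ∧-assoc (U x) _ _)) ⟨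
    countFin (λ x → (U x ∧ not (x =ᶠ a)) ∧ not (x =ᶠ b)) + 1 + 1
      ≡⟨ cong (_+ 1) (countFin-remove (λ x → U x ∧ not (x =ᶠ a)) U∖a∋b) ⟩
    countFin (λ x → U x ∧ not (x =ᶠ a)) + 1 ≡⟨ countFin-remove U Ua ⟩
    countFin U ∎
    where
    open ≡-Reasoning
    U∖a∋b : (U b ∧ not (b =ᶠ a)) ≡ true
    U∖a∋b = ∧-true⁺ Ub (not-true⁺ (≢⇒=ᶠ-false (λ b≡a → a≢b (sym b≡a))))

  module _ (U S : Fin N → Bool) {a : Fin N} (Ua : U a ≡ true) (Sa : S a ≡ true) where
    partner : Fin N → Bool
    partner b = U b ∧ not (b =ᶠ a) ∧ (S b ⇔ᵇ S a)

    partner⁻ : ∀ {b} → partner b ≡ true → U b ≡ true × a ≢ b × S b ≡ S a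
    partner⁻ {b} h with ∧-true⁻ {U b} h
    ... | Ub , h′ with ∧-true⁻ {not (b =ᶠ a)} h′
    ... | b≢a , Sb≡Sa = Ub , (λ a≡b → =ᶠ-false⇒≢ (not-true⁻ b≢a) (sym a≡b)) , ⇔ᵇ⇒≡ Sb≡Sa

    countMaps-through-nonpartner : ∀ {b} → partner b ≡ false →
                                   countMaps (λ β → isColouredMatching U S β ∧ (β a =ᶠ b)) ≡ 0
    countMaps-through-nonpartner {b} ¬partner = count-none _ (allMaps N) none
      where
      none : ∀ {β} → β ∈ allMaps N → (isColouredMatching U S β ∧ (β a =ᶠ b)) ≡ false
      none {β} _ with isColouredMatching U S β in cm | β a =ᶠ b in βa
      ... | false | _     = refl
      ... | true  | false = refl
      ... | true  | true with =ᶠ⇒≡ βa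
      ... | refl = ⊥-elim (true≢false isPartner ¬partner)
        where
        open Matched (ColouredMatching.matched (isColouredMatching⁻ {U = U} {S = S} cm) Ua)
        isPartner : partner (β a) ≡ true
        isPartner = ∧-true⁺ stays (∧-true⁺ (not-true⁺ (≢⇒=ᶠ-false moves)) (≡⇒⇔ᵇ keepsColour))

    countFin-partner : countFin partner + 1 ≡ countFin (U ∩ᵇ S)
    countFin-partner = trans (cong (_+ 1) (countFin-cong same)) (countFin-remove (U ∩ᵇ S) (∧-true⁺ Ua Sa))
      where
      same : ∀ b → partner b ≡ (U b ∧ S b) ∧ not (b =ᶠ a)
      same b rewrite Sa with U b | S b
      ... | false | _     = refl
      ... | true  | true  = ∧-identityʳ _
      ... | true  | false = ∧-zeroʳ _

    module _ {b : Fin N} (isPartner : partner b ≡ true) where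
      private
        Ub    = proj₁ (partner⁻ isPartner)
        a≢b   = proj₁ (proj₂ (partner⁻ isPartner))
        Sb≡Sa = proj₂ (proj₂ (partner⁻ isPartner))

      countFin-remove₂-∩ : countFin (remove₂ U a b ∩ᵇ S) + 2 ≡ countFin (U ∩ᵇ S)
      countFin-remove₂-∩ = trans (cong (_+ 2) (countFin-cong reassoc))
                                 (countFin-remove₂ (U ∩ᵇ S) (∧-true⁺ Ua Sa) (∧-true⁺ Ub (trans Sb≡Sa Sa)) a≢b)
        where
        reassoc : ∀ x → (remove₂ U a b ∩ᵇ S) x ≡ remove₂ (U ∩ᵇ S) a b x
        reassoc x with U x | S x
        ... | false | _     = refl
        ... | true  | true  = ∧-identityʳ _
        ... | true  | false = ∧-zeroʳ _

      countFin-remove₂-∩∁ : countFin (remove₂ U a b ∩ᵇ ∁ᵇ S) ≡ countFin (U ∩ᵇ ∁ᵇ S)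
      countFin-remove₂-∩∁ = countFin-cong (λ x → by-cases x (x Fin.≟ a) (x Fin.≟ b))
        where
        by-cases : ∀ x → Dec (x ≡ a) → Dec (x ≡ b) → (remove₂ U a b ∩ᵇ ∁ᵇ S) x ≡ (U ∩ᵇ ∁ᵇ S) x
        by-cases x (yes refl) _ rewrite remove₂-a U x b | Sa = sym (∧-zeroʳ (U x))
        by-cases x (no _) (yes refl) rewrite remove₂-b U a x | Sb≡Sa | Sa = sym (∧-zeroʳ (U x))
        by-cases x (no x≢a) (no x≢b) rewrite remove₂-other U a b x≢a x≢b = refl

    matchingFormula-step : (∀ {b} → partner b ≡ true → MatchingFormula (remove₂ U a b) S) → MatchingFormula U S
    matchingFormula-step formula = begin
      countMaps (isColouredMatching U S)
        ≡⟨ count-by-value (isColouredMatching U S) (λ β → β a) (allMaps N) ⟩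
      sumBy (λ b → countMaps (λ β → isColouredMatching U S β ∧ (β a =ᶠ b))) (allFin N)
        ≡⟨ sumBy-cong (allFin N) (λ {b} _ → through b) ⟩
      sumBy (λ b → indicator (partner b) * rest) (allFin N)
        ≡⟨ sumBy-*ʳ (λ b → indicator (partner b)) rest (allFin N) ⟩
      sumBy (λ b → indicator (partner b)) (allFin N) * rest
        ≡⟨ cong (_* rest) (sumBy-indicator partner (allFin N)) ⟩
      countFin partner * rest
        ≡⟨ *-assoc (countFin partner) _ identityCount ⟨
      countFin partner * (matchings (countFin (U ∩ᵇ S) ∸ 2) * m∁) * identityCount
        ≡⟨ cong (_* identityCount) (*-assoc (countFin partner) _ m∁) ⟨
      countFin partner * matchings (countFin (U ∩ᵇ S) ∸ 2) * m∁ * identityCount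
        ≡⟨ cong (λ c → c * m∁ * identityCount) first-step ⟩
      matchings (countFin (U ∩ᵇ S)) * m∁ * identityCount ∎
      where
      open ≡-Reasoning
      m∁ = matchings (countFin (U ∩ᵇ ∁ᵇ S))
      rest = matchings (countFin (U ∩ᵇ S) ∸ 2) * m∁ * identityCount
      through : ∀ b → countMaps (λ β → isColouredMatching U S β ∧ (β a =ᶠ b)) ≡ indicator (partner b) * rest
      through b with partner b in isPartner
      ... | false = countMaps-through-nonpartner isPartner
      ... | true  = begin
        countMaps (λ β → isColouredMatching U S β ∧ (β a =ᶠ b))
          ≡⟨ countMaps-matching-through U S Ua Ub a≢b Sb≡Sa ⟩
        countMaps (isColouredMatching (remove₂ U a b) S)
          ≡⟨ formula isPartner ⟩
        matchings (countFin (remove₂ U a b ∩ᵇ S)) * matchings (countFin (remove₂ U a b ∩ᵇ ∁ᵇ S)) * identityCount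
          ≡⟨ cong₂ (λ c c∁ → matchings c * matchings c∁ * identityCount)
                   (trans (sym (m+n∸n≡m (countFin (remove₂ U a b ∩ᵇ S)) 2))
                          (cong (_∸ 2) (countFin-remove₂-∩ isPartner)))
                   (countFin-remove₂-∩∁ isPartner) ⟩
        rest
          ≡⟨ +-identityʳ rest ⟨
        1 * rest ∎
        where
        Ub    = proj₁ (partner⁻ isPartner)
        a≢b   = proj₁ (proj₂ (partner⁻ isPartner))
        Sb≡Sa = proj₂ (proj₂ (partner⁻ isPartner))
      first-step : countFin partner * matchings (countFin (U ∩ᵇ S) ∸ 2) ≡ matchings (countFin (U ∩ᵇ S))
      first-step rewrite sym countFin-partner | +-comm (countFin partner) 1 =
        sym (matchings-suc (countFin partner))

  matchingFormula : ∀ (U S : Fin N → Bool) → MatchingFormula U S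
  matchingFormula U S = by-size (countFin U) U S ≤-refl
    where
    by-size : ∀ n U S → countFin U ≤ n → MatchingFormula U S
    by-size n U S U≤n with countFin U in |U|
    ... | zero = matchingFormula-∅ S |U|
    by-size (suc n) U S (s≤s k≤n) | suc k with a , Ua ← countFin-pos U (subst (0 <_) (sym |U|) (s≤s z≤n))
      = by-colour (S a) refl
      where
      smaller : ∀ {b} → U b ≡ true → a ≢ b → countFin (remove₂ U a b) ≤ n
      smaller {b} Ub a≢b = ≤-pred (begin
        suc (countFin (remove₂ U a b))      ≤⟨ s≤s (m≤m+n _ 1) ⟩
        suc (countFin (remove₂ U a b) + 1)  ≡⟨ +-suc _ 1 ⟨
        countFin (remove₂ U a b) + 2        ≡⟨ trans (countFin-remove₂ U Ua Ub a≢b) |U| ⟩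
        suc k                               ≤⟨ s≤s k≤n ⟩
        suc n                               ∎)
        where open ≤-Reasoning
      by-colour : (c : Bool) → S a ≡ c → MatchingFormula U S
      by-colour true  Sa = matchingFormula-step U S Ua Sa λ isPartner →
        let Ub , a≢b , _ = partner⁻ U S Ua Sa isPartner in by-size n _ S (smaller Ub a≢b)
      by-colour false Sa = matchingFormula-∁ U S (matchingFormula-step U (∁ᵇ S) Ua (cong not Sa) λ isPartner →
        let Ub , a≢b , _ = partner⁻ U (∁ᵇ S) Ua (cong not Sa) isPartner in by-size n _ (∁ᵇ S) (smaller Ub a≢b))

  preserves : (T : Fin N → Bool) → Map N → Bool
  preserves T β = allB (λ y → not (T y) ∨ T (β y))

  preservingInvolution : (T : Fin N → Bool) → Map N → Bool
  preservingInvolution T β = inClass2 N β ∧ preserves T β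

  module _ (T : Fin N → Bool) {β : Map N} where
    preservingInvolution⁻ : preservingInvolution T β ≡ true → ColouredMatching (λ _ → true) T β
    preservingInvolution⁻ h = record { matched = λ {x} _ → matched x ; fixed = λ () }
      where
      inv = allB-true⁻ _ (proj₂ (∧-true⁻ {isPerm β} (proj₁ (∧-true⁻ h))))
      into : ∀ {y} → T y ≡ true → T (β y) ≡ true
      into {y} Ty with ∨-true⁻ {not (T y)} (allB-true⁻ _ (proj₂ (∧-true⁻ {inClass2 N β} h)) y)
      ... | inj₁ ¬Ty = ⊥-elim (true≢false Ty (not-true⁻ ¬Ty))
      ... | inj₂ Tβy = Tβy
      matched : ∀ x → Matched (λ _ → true) T β x
      matched x = record { moves = moves ; involutive = involutive ; stays = refl ; keepsColour = keepsColour }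
        where
        moves = =ᶠ-false⇒≢ (not-true⁻ (proj₂ (∧-true⁻ (inv x))))
        involutive = =ᶠ⇒≡ (proj₁ (∧-true⁻ {β (β x) =ᶠ x} (inv x)))
        keepsColour : T (β x) ≡ T x
        keepsColour with T x in Tx | T (β x) in Tβx
        ... | true  | _     = trans (sym Tβx) (into Tx)
        ... | false | false = refl
        ... | false | true  = ⊥-elim (true≢false (subst (λ z → T z ≡ true) involutive (into Tβx)) Tx)

    preservingInvolution⁺ : ColouredMatching (λ _ → true) T β → preservingInvolution T β ≡ true
    preservingInvolution⁺ cm = ∧-true⁺ (∧-true⁺ perm inv) (allB-true⁺ _ into)
      where
      open ColouredMatching cm
      open Matched
      perm : isPerm β ≡ true
      perm = allB-true⁺ _ λ x → allB-true⁺ _ λ y → injective x y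
        where
        injective : ∀ x y → (not (β x =ᶠ β y) ∨ (x =ᶠ y)) ≡ true
        injective x y with β x =ᶠ β y in βx=βy
        ... | false = refl
        ... | true  = ≡⇒=ᶠ (trans (sym (involutive (matched refl)))
                                  (trans (cong β (=ᶠ⇒≡ βx=βy)) (involutive (matched refl))))
      inv : allB (λ x → (β (β x) =ᶠ x) ∧ not (β x =ᶠ x)) ≡ true
      inv = allB-true⁺ (λ x → (β (β x) =ᶠ x) ∧ not (β x =ᶠ x)) λ x →
        ∧-true⁺ (≡⇒=ᶠ (involutive (matched {x} refl))) (not-true⁺ (≢⇒=ᶠ-false (moves (matched {x} refl))))
      into : ∀ y → (not (T y) ∨ T (β y)) ≡ true
      into y with T y in Ty
      ... | false = refl
      ... | true  = trans (keepsColour (matched {y} refl)) Ty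

  countMaps-preservingInvolution : ∀ T → countMaps (preservingInvolution T)
                                 ≡ matchings (countFin T) * matchings (N ∸ countFin T) * identityCount
  countMaps-preservingInvolution T = begin
    countMaps (preservingInvolution T)
      ≡⟨ countMaps-⇔ _ _ ext (isColouredMatching-ext _ T)
           (λ h → isColouredMatching⁺ (preservingInvolution⁻ T h))
           (λ h → preservingInvolution⁺ T (isColouredMatching⁻ h)) ⟩
    countMaps (isColouredMatching (λ _ → true) T)
      ≡⟨ matchingFormula (λ _ → true) T ⟩
    matchings (countFin T) * matchings (countFin (∁ᵇ T)) * identityCount
      ≡⟨ cong (λ c → matchings (countFin T) * matchings c * identityCount)
              (trans (sym (m+n∸m≡n (countFin T) _)) (cong (_∸ countFin T) (countFin+countFin-not T))) ⟩
    matchings (countFin T) * matchings (N ∸ countFin T) * identityCount ∎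
    where
    open ≡-Reasoning
    ext : Extensional (preservingInvolution T)
    ext {f} {g} f≗g = cong₂ _∧_ (cong₂ _∧_
      (allB-cong λ x → allB-cong λ y → cong (λ b → not b ∨ (x =ᶠ y)) (cong₂ _=ᶠ_ (f≗g x) (f≗g y)))
      (allB-cong λ x → cong₂ (λ u v → (u =ᶠ x) ∧ not (v =ᶠ x)) (trans (f≗g (f x)) (cong g (f≗g x))) (f≗g x)))
      (allB-cong λ y → cong (λ z → not (T y) ∨ T z) (f≗g y))

  sizeClass2≡ : sizeClass2 N ≡ matchings N * identityCount
  sizeClass2≡ = begin
    sizeClass2 N
      ≡⟨ count-cong (allMaps N) (λ {β} _ → sym (preserves-all β)) ⟩
    countMaps (preservingInvolution (λ _ → true))
      ≡⟨ countMaps-preservingInvolution (λ _ → true) ⟩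
    matchings all * matchings (N ∸ all) * identityCount
      ≡⟨ cong (λ c → matchings c * matchings (N ∸ c) * identityCount) all≡N ⟩
    matchings N * matchings (N ∸ N) * identityCount
      ≡⟨ cong (λ c → matchings N * matchings c * identityCount) (n∸n≡0 N) ⟩
    matchings N * 1 * identityCount
      ≡⟨ cong (_* identityCount) (*-identityʳ (matchings N)) ⟩
    matchings N * identityCount ∎
    where
    open ≡-Reasoning
    all = countFin {N} (λ _ → true)
    all≡N : all ≡ N
    all≡N = trans (sym (+-identityʳ all))
                  (trans (cong (all +_) (sym (count-none (λ _ → false) (allFin N) (λ _ → refl))))
                         (countFin+countFin-not (λ _ → true)))
    preserves-all : ∀ β → preservingInvolution (λ _ → true) β ≡ inClass2 N β
    preserves-all β = trans (cong (inClass2 N β ∧_) (allB-true⁺ {N} (λ _ → true) (λ _ → refl))) (∧-identityʳ _)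

  preservingInvolutions-ratio : ∀ T → countMaps (preservingInvolution T) * matchings N
                              ≡ matchings (countFin T) * matchings (N ∸ countFin T) * sizeClass2 N
  preservingInvolutions-ratio T = begin
    countMaps (preservingInvolution T) * matchings N
      ≡⟨ cong (_* matchings N) (countMaps-preservingInvolution T) ⟩
    mT * m∁T * identityCount * matchings N
      ≡⟨ *-assoc (mT * m∁T) identityCount (matchings N) ⟩
    mT * m∁T * (identityCount * matchings N)
      ≡⟨ cong (mT * m∁T *_) (*-comm identityCount (matchings N)) ⟩
    mT * m∁T * (matchings N * identityCount)
      ≡⟨ cong (mT * m∁T *_) sizeClass2≡ ⟨
    mT * m∁T * sizeClass2 N ∎
    where
    open ≡-Reasoning
    mT  = matchings (countFin T)
    m∁T = matchings (N ∸ countFin T)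

-- Orbits of ⟨α, β⟩

module _ {N : ℕ} (f : Map N) where
  iter-+ : ∀ a b x → iter f (a + b) x ≡ iter f a (iter f b x)
  iter-+ zero    b x = refl
  iter-+ (suc a) b x = cong f (iter-+ a b x)

  iter-suc : ∀ k x → iter f (suc k) x ≡ iter f k (f x)
  iter-suc k x = trans (cong (λ i → iter f i x) (+-comm 1 k)) (iter-+ k 1 x)

  iter-closed : (T : Fin N → Bool) → (∀ {z} → T z ≡ true → T (f z) ≡ true) →
                ∀ k {z} → T z ≡ true → T (iter f k z) ≡ true
  iter-closed T closed zero    Tz = Tz
  iter-closed T closed (suc k) Tz = closed (iter-closed T closed k Tz)

module Reach {N : ℕ} (α β : Map N) where
  R : ℕ → Fin N → Fin N → Bool
  R = reach α β

  R-suc : ∀ k {x y} → R k x y ≡ true → R (suc k) x y ≡ true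
  R-suc k h = ∨-trueˡ h

  R-step : ∀ k {x z y} → R k x z ≡ true → α z ≡ y ⊎ β z ≡ y → R (suc k) x y ≡ true
  R-step k {x} {z} {y} h e = ∨-trueʳ {R k x y} (any-true⁺ _ (∈-allFin z) (∧-true⁺ h (edge e)))
    where
    edge : α z ≡ y ⊎ β z ≡ y → ((α z =ᶠ y) ∨ (β z =ᶠ y)) ≡ true
    edge (inj₁ αz≡y) = ∨-trueˡ (≡⇒=ᶠ αz≡y)
    edge (inj₂ βz≡y) = ∨-trueʳ {α z =ᶠ y} (≡⇒=ᶠ βz≡y)

  R-refl : ∀ k x → R k x x ≡ true
  R-refl zero    x = =ᶠ-refl x
  R-refl (suc k) x = R-suc k (R-refl k x)

  Stable : ℕ → Fin N → Set
  Stable k x = ∀ y → R (suc k) x y ≡ R k x y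

  stable-suc : ∀ {k x} → Stable k x → Stable (suc k) x
  stable-suc {k} {x} st y =
    cong₂ _∨_ (st y) (any-cong (λ z → cong (_∧ ((α z =ᶠ y) ∨ (β z =ᶠ y))) (st z)) (allFin N))

  stable-≤ : ∀ {j k x} → j ≤ k → Stable j x → Stable k x
  stable-≤ {j} {x = x} j≤k st with o , refl ← m≤n⇒∃[o]m+o≡n j≤k = from o
    where
    from : ∀ o → Stable (j + o) x
    from zero    = subst (λ t → Stable t x) (sym (+-identityʳ j)) st
    from (suc o) = subst (λ t → Stable t x) (sym (+-suc j o)) (stable-suc {j + o} (from o))

  stable-or-large : ∀ k x → Σ ℕ (λ j → j ≤ k × Stable j x) ⊎ k < countFin (R k x)
  stable-or-large zero    x = inj₂ (∈⇒count-pos (R 0 x) (∈-allFin x) (=ᶠ-refl x))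
  stable-or-large (suc k) x with stable-or-large k x
  ... | inj₁ (j , j≤k , st) = inj₁ (j , m≤n⇒m≤1+n j≤k , st)
  ... | inj₂ large with allB (λ y → R (suc k) x y ⇔ᵇ R k x y) in same
  ...   | true  = inj₁ (k , n≤1+n k , λ y → ⇔ᵇ⇒≡ (allB-true⁻ (λ y → R (suc k) x y ⇔ᵇ R k x y) same y))
  ...   | false with y , _ , differs ← all-false⁻ (λ y → R (suc k) x y ⇔ᵇ R k x y) {allFin N} same =
    inj₂ (≤-trans (s≤s large) grows)
    where
    grows : countFin (R k x) < countFin (R (suc k) x)
    grows with Rsuc , ¬R ← ⇔ᵇ-false⁻ (R-suc k) differs =
      count-< (R k x) (R (suc k) x) (allFin N) (λ _ → R-suc k) (∈-allFin y) Rsuc ¬R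

  stable-N : ∀ x → Stable N x
  stable-N x with stable-or-large N x
  ... | inj₁ (j , j≤N , st) = stable-≤ j≤N st
  ... | inj₂ large          = ⊥-elim (<-irrefl refl (≤-trans large (countFin≤N (R N x))))

  sameOrbit-α : ∀ {x z} → sameOrbit α β x z ≡ true → sameOrbit α β x (α z) ≡ true
  sameOrbit-α {x} {z} h = trans (sym (stable-N x (α z))) (R-step N h (inj₁ refl))

  sameOrbit-β : ∀ {x z} → sameOrbit α β x z ≡ true → sameOrbit α β x (β z) ≡ true
  sameOrbit-β {x} {z} h = trans (sym (stable-N x (β z))) (R-step N h (inj₂ refl))

  sameOrbit-refl : ∀ x → sameOrbit α β x x ≡ true
  sameOrbit-refl = R-refl N

record InvariantHalf {N : ℕ} (α β : Map N) : Set where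
  field
    T          : Fin N → Bool
    α-closed   : ∀ {z} → T z ≡ true → T (α z) ≡ true
    β-closed   : ∀ {z} → T z ≡ true → T (β z) ≡ true
    nonempty   : 0 < countFin T
    atMostHalf : countFin T * 2 ≤ N

module _ {N : ℕ} (α β : Map N) where
  open Reach α β

  leastInOrbit : Fin N → Bool
  leastInOrbit x = allB (λ y → not (sameOrbit α β x y) ∨ ⌊ toℕ x Data.Nat.≤? toℕ y ⌋)

  module _ (0<N : 0 < N) where
    private
      z₀ : Fin N
      z₀ = Fin.fromℕ< 0<N

    z₀-least : leastInOrbit z₀ ≡ true
    z₀-least = allB-true⁺ _ λ y → ∨-trueʳ {not (sameOrbit α β z₀ y)}
      (≤⇒⌊≤?⌋ (subst (_≤ toℕ y) (sym (Fin.toℕ-fromℕ< 0<N)) z≤n))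

    another-least : numOrbits N α β ≢ 1 → Σ (Fin N) λ y → (leastInOrbit y ∧ not (y =ᶠ z₀)) ≡ true
    another-least numOrbits≢1 with countFin (λ y → leastInOrbit y ∧ not (y =ᶠ z₀)) in c
    ... | suc _ = countFin-pos _ (subst (0 <_) (sym c) (s≤s z≤n))
    ... | zero  = ⊥-elim (numOrbits≢1 (begin
      numOrbits N α β
        ≡⟨ countFin-remove leastInOrbit z₀-least ⟨
      countFin (λ y → leastInOrbit y ∧ not (y =ᶠ z₀)) + 1
        ≡⟨ cong (_+ 1) c ⟩
      1 ∎))
      where open ≡-Reasoning

    separatedPoints : numOrbits N α β ≢ 1 → Σ (Fin N) λ x → Σ (Fin N) λ w → sameOrbit α β x w ≡ false
    separatedPoints numOrbits≢1 with y , least-y ← another-least numOrbits≢1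
      with ∧-true⁻ {leastInOrbit y} least-y
    ... | least , y≢z₀ = y , z₀ , y≁z₀
      where
      y≁z₀ : sameOrbit α β y z₀ ≡ false
      y≁z₀ with sameOrbit α β y z₀ in y∼z₀
      ... | false = refl
      ... | true with ∨-true⁻ {not (sameOrbit α β y z₀)} (allB-true⁻ _ least z₀)
      ...   | inj₁ y≁z₀ = ⊥-elim (true≢false y∼z₀ (not-true⁻ y≁z₀))
      ...   | inj₂ y≤z₀ = ⊥-elim (=ᶠ-false⇒≢ (not-true⁻ y≢z₀)
                              (Fin.toℕ-injective (trans (n≤0⇒n≡0 y≤0) (sym (Fin.toℕ-fromℕ< 0<N)))))
        where
        y≤0 : toℕ y ≤ 0
        y≤0 = subst (toℕ y ≤_) (Fin.toℕ-fromℕ< 0<N) (⌊≤?⌋⇒≤ y≤z₀)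

  -- T is the orbit of x or its complement, whichever has at most N/2 points. The complement is
  -- β-closed as β is an involution, and α-closed as α is periodic.
  invariantHalf : (∀ z → β (β z) ≡ z) → (∀ z → Σ ℕ λ L → iter α (suc L) z ≡ z) →
                  0 < N → numOrbits N α β ≢ 1 → InvariantHalf α β
  invariantHalf β-invol α-periodic 0<N numOrbits≢1
    with x , w , x≁w ← separatedPoints 0<N numOrbits≢1
    with ≤-total (countFin (sameOrbit α β x) * 2) N
  ... | inj₁ small = record
    { T = sameOrbit α β x ; α-closed = sameOrbit-α ; β-closed = sameOrbit-β
    ; nonempty = ∈⇒count-pos _ (∈-allFin x) (sameOrbit-refl x) ; atMostHalf = small }
  ... | inj₂ large = record
    { T = ∁O ; α-closed = ∁O-α ; β-closed = ∁O-β
    ; nonempty = ∈⇒count-pos ∁O (∈-allFin w) (not-true⁺ x≁w) ; atMostHalf = ∁O-small }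
    where
    O ∁O : Fin N → Bool
    O = sameOrbit α β x
    ∁O z = not (O z)
    ∁-closed : ∀ {f : Map N} → (∀ {z} → O (f z) ≡ true → O z ≡ true) →
               ∀ {z} → ∁O z ≡ true → ∁O (f z) ≡ true
    ∁-closed {f} back {z} ∁Oz with O (f z) in Ofz
    ... | false = refl
    ... | true  = ⊥-elim (true≢false (back Ofz) (not-true⁻ ∁Oz))
    ∁O-α : ∀ {z} → ∁O z ≡ true → ∁O (α z) ≡ true
    ∁O-α = ∁-closed λ {z} Oαz → let L , αᴸ⁺¹z≡z = α-periodic z in
      subst (λ t → O t ≡ true) αᴸ⁺¹z≡z
        (subst (λ t → O t ≡ true) (sym (iter-suc α L z)) (iter-closed α O sameOrbit-α L Oαz))
    ∁O-β : ∀ {z} → ∁O z ≡ true → ∁O (β z) ≡ true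
    ∁O-β = ∁-closed λ {z} Oβz → subst (λ t → O t ≡ true) (β-invol z) (sameOrbit-β Oβz)
    ∁O-small : countFin ∁O * 2 ≤ N
    ∁O-small = +-cancelˡ-≤ (countFin O * 2) _ _ (begin
      countFin O * 2 + countFin ∁O * 2  ≡⟨ *-distribʳ-+ 2 (countFin O) (countFin ∁O) ⟨
      (countFin O + countFin ∁O) * 2    ≡⟨ cong (_* 2) (countFin+countFin-not O) ⟩
      N * 2                             ≡⟨ *-comm N 2 ⟩
      N + (N + 0)                       ≡⟨ cong (N +_) (+-identityʳ N) ⟩
      N + N                             ≤⟨ +-monoˡ-≤ N large ⟩
      countFin O * 2 + N                ∎)
      where open ≤-Reasoning

-- Cycles of α

argmin-upTo< : ∀ (f : ℕ → ℕ) {n} → 0 < n → Extrema.argmin f 0 (upTo n) < n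
argmin-upTo< f {n} 0<n with Extrema.argmin-sel f 0 (upTo n)
... | inj₁ argmin≡0   = subst (_< n) (sym argmin≡0) 0<n
... | inj₂ argmin∈upTo = ∈.∈-upTo⁻ argmin∈upTo

module Cycles {N : ℕ} (α : Map N) (α-injective : ∀ {x y} → α x ≡ α y → x ≡ y) where
  iter-injective : ∀ k {x y} → iter α k x ≡ iter α k y → x ≡ y
  iter-injective zero    e = e
  iter-injective (suc k) e = iter-injective k (α-injective e)

  opaque
    period : ∀ x → Σ ℕ λ L → suc L ≤ N × iter α (suc L) x ≡ x
    period x with i , j , i<j , αⁱx≡αʲx ← Fin.pigeonhole (n<1+n N) (λ (i : Fin (suc N)) → iter α (toℕ i) x)
      with d , i+d≡j ← m≤n⇒∃[o]m+o≡n i<j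
      = d , ≤-trans (m≤n+m (suc d) (toℕ i))
                    (≤-trans (≤-reflexive (trans (+-suc _ d) i+d≡j)) (≤-pred (Fin.toℕ<n j)))
          , iter-injective (toℕ i) (begin
            iter α (toℕ i) (iter α (suc d) x)
              ≡⟨ iter-+ α (toℕ i) (suc d) x ⟨
            iter α (toℕ i + suc d) x
              ≡⟨ cong (λ t → iter α t x) (trans (+-suc _ d) i+d≡j) ⟩
            iter α (toℕ j) x
              ≡⟨ αⁱx≡αʲx ⟨
            iter α (toℕ i) x ∎)
      where open ≡-Reasoning

  ℓ : Fin N → ℕ
  ℓ x = suc (proj₁ (period x))

  ℓ≤N : ∀ x → ℓ x ≤ N
  ℓ≤N x = proj₁ (proj₂ (period x))

  iter-ℓ : ∀ x → iter α (ℓ x) x ≡ x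
  iter-ℓ x = proj₂ (proj₂ (period x))

  iter-*ℓ : ∀ q x → iter α (q * ℓ x) x ≡ x
  iter-*ℓ zero    x = refl
  iter-*ℓ (suc q) x = trans (iter-+ α (ℓ x) (q * ℓ x) x) (trans (cong (iter α (ℓ x)) (iter-*ℓ q x)) (iter-ℓ x))

  iter-%ℓ : ∀ e x → iter α e x ≡ iter α (e % ℓ x) x
  iter-%ℓ e x = begin
    iter α e x
      ≡⟨ cong (λ t → iter α t x) (m≡m%n+[m/n]*n e (ℓ x)) ⟩
    iter α (e % ℓ x + e / ℓ x * ℓ x) x
      ≡⟨ iter-+ α (e % ℓ x) _ x ⟩
    iter α (e % ℓ x) (iter α (e / ℓ x * ℓ x) x)
      ≡⟨ cong (iter α (e % ℓ x)) (iter-*ℓ (e / ℓ x) x) ⟩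
    iter α (e % ℓ x) x ∎
    where open ≡-Reasoning

  iter-undo : ∀ q {k x} → k ≤ q * ℓ x → iter α (q * ℓ x ∸ k) (iter α k x) ≡ x
  iter-undo q {k} {x} k≤qℓ = begin
    iter α (q * ℓ x ∸ k) (iter α k x)  ≡⟨ iter-+ α (q * ℓ x ∸ k) k x ⟨
    iter α (q * ℓ x ∸ k + k) x         ≡⟨ cong (λ t → iter α t x) (m∸n+n≡m k≤qℓ) ⟩
    iter α (q * ℓ x) x                 ≡⟨ iter-*ℓ q x ⟩
    x                                  ∎
    where open ≡-Reasoning

  iter-below-N : ∀ k x → Σ ℕ λ k′ → k′ < N × iter α k′ x ≡ iter α k x
  iter-below-N k x = k % ℓ x , ≤-trans (m%n<n k (ℓ x)) (ℓ≤N x) , sym (iter-%ℓ k x)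

  isCycleMin : Fin N → Bool
  isCycleMin x = BL.all (λ k → ⌊ toℕ x Data.Nat.≤? toℕ (iter α k x) ⌋) (upTo N)

  isCycleMin⁻ : ∀ {x} → isCycleMin x ≡ true → ∀ e → toℕ x ≤ toℕ (iter α e x)
  isCycleMin⁻ {x} h e with k , k<N , αᵏx≡αᵉx ← iter-below-N e x =
    subst (λ t → toℕ x ≤ toℕ t) αᵏx≡αᵉx (⌊≤?⌋⇒≤ (all-true⁻ _ h (∈.∈-upTo⁺ k<N)))

  isCycleMin⁺ : ∀ {x} → (∀ e → toℕ x ≤ toℕ (iter α e x)) → isCycleMin x ≡ true
  isCycleMin⁺ h = all-true⁺ _ (upTo N) (λ {k} _ → ≤⇒⌊≤?⌋ (h k))

  cycleMin-unique : ∀ {x x′ k} → isCycleMin x ≡ true → isCycleMin x′ ≡ true → iter α k x ≡ x′ → x ≡ x′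
  cycleMin-unique {x} {x′} {k} min-x min-x′ αᵏx≡x′ = Fin.toℕ-injective (≤-antisym x≤x′ x′≤x)
    where
    x≤x′ = subst (λ t → toℕ x ≤ toℕ t) αᵏx≡x′ (isCycleMin⁻ min-x k)
    x′≤x = subst (λ t → toℕ x′ ≤ toℕ t)
                 (trans (cong (iter α (k * ℓ x ∸ k)) (sym αᵏx≡x′)) (iter-undo k (m≤m*n k (ℓ x))))
                 (isCycleMin⁻ min-x′ (k * ℓ x ∸ k))

  cycleMins-meet : ∀ {x x′} i i′ → isCycleMin x ≡ true → isCycleMin x′ ≡ true →
                   iter α i x ≡ iter α i′ x′ → x ≡ x′
  cycleMins-meet {x} {x′} i i′ min-x min-x′ αⁱx≡αⁱ′x′ =
    cycleMin-unique {k = i′ * ℓ x′ ∸ i′ + i} min-x min-x′ (begin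
    iter α (i′ * ℓ x′ ∸ i′ + i) x                ≡⟨ iter-+ α (i′ * ℓ x′ ∸ i′) i x ⟩
    iter α (i′ * ℓ x′ ∸ i′) (iter α i x)         ≡⟨ cong (iter α (i′ * ℓ x′ ∸ i′)) αⁱx≡αⁱ′x′ ⟩
    iter α (i′ * ℓ x′ ∸ i′) (iter α i′ x′)       ≡⟨ iter-undo i′ (m≤m*n i′ (ℓ x′)) ⟩
    x′                                           ∎)
    where open ≡-Reasoning

  record CycleMin (y : Fin N) : Set where
    field
      min     : Fin N
      isMin   : isCycleMin min ≡ true
      j       : ℕ
      reaches : iter α j y ≡ min
      k       : ℕ
      returns : iter α k min ≡ y

  cycleMin : ∀ y → CycleMin y
  cycleMin y = record
    { min = iter α j y ; isMin = isCycleMin⁺ minimal ; j = j ; reaches = refl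
    ; k = ℓ y ∸ j
    ; returns = subst (λ t → iter α (t ∸ j) (iter α j y) ≡ y) (*-identityˡ (ℓ y)) (iter-undo 1 j≤ℓ) }
    where
    f : ℕ → ℕ
    f i = toℕ (iter α i y)
    j = Extrema.argmin f 0 (upTo (ℓ y))
    j≤ℓ : j ≤ 1 * ℓ y
    j≤ℓ = ≤-trans (<⇒≤ (argmin-upTo< f (s≤s z≤n))) (≤-reflexive (sym (*-identityˡ (ℓ y))))
    minimal : ∀ e → f j ≤ toℕ (iter α e (iter α j y))
    minimal e = subst (λ t → f j ≤ toℕ t)
      (sym (trans (sym (iter-+ α e j y)) (iter-%ℓ (e + j) y)))
      (All.lookup (Extrema.f[argmin]≤f[xs] {f = f} 0 (upTo (ℓ y))) (∈.∈-upTo⁺ (m%n<n (e + j) (ℓ y))))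

module _ {a} {A : Set a} where
  sublists : List A → List (List A)
  sublists []       = [] ∷ []
  sublists (x ∷ xs) = sublists xs ++ map (x ∷_) (sublists xs)

  filter∈sublists : (p : A → Bool) (xs : List A) → filter (λ x → p x Bool.≟ true) xs ∈ sublists xs
  filter∈sublists p []       = here refl
  filter∈sublists p (x ∷ xs) with p x
  ... | true  = ∈.∈-++⁺ʳ (sublists xs) (∈.∈-map⁺ (x ∷_) (filter∈sublists p xs))
  ... | false = ∈.∈-++⁺ˡ (filter∈sublists p xs)

module CycleSets {N : ℕ} (α : Map N) (α-injective : ∀ {x y} → α x ≡ α y → x ≡ y)
                 (α-no-fixed-point : ∀ x → α x ≢ x) (α-no-2-cycle : ∀ x → α (α x) ≢ x) where
  open Cycles α α-injective

  triples : List (Fin N) → List (Fin N)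
  triples []       = []
  triples (x ∷ xs) = x ∷ α x ∷ α (α x) ∷ triples xs

  length-triples : ∀ xs → length (triples xs) ≡ length xs * 3
  length-triples []       = refl
  length-triples (x ∷ xs) = cong (λ n → suc (suc (suc n))) (length-triples xs)

  ∈-triples⁻ : ∀ xs {z} → z ∈ triples xs → Σ (Fin N) λ x → x ∈ xs × Σ ℕ λ i → i < 3 × iter α i x ≡ z
  ∈-triples⁻ (x ∷ xs) (here refl)                 = x , here refl , 0 , s≤s z≤n , refl
  ∈-triples⁻ (x ∷ xs) (there (here refl))         = x , here refl , 1 , s≤s (s≤s z≤n) , refl
  ∈-triples⁻ (x ∷ xs) (there (there (here refl))) = x , here refl , 2 , s≤s (s≤s (s≤s z≤n)) , refl
  ∈-triples⁻ (x ∷ xs) (there (there (there z∈))) with y , y∈xs , i , i<3 , αⁱy≡z ← ∈-triples⁻ xs z∈ =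
    y , there y∈xs , i , i<3 , αⁱy≡z

  -- x, α x, α² x are distinct as α has no cycles of length 1 or 2, and the triples of
  -- distinct cycle minima are disjoint because they lie on distinct cycles.
  triples-unique : ∀ {xs} → Unique xs → All.All (λ x → isCycleMin x ≡ true) xs → Unique (triples xs)
  triples-unique {[]}     []          _                 = []
  triples-unique {x ∷ xs} (x∉xs ∷ u) (min-x All.∷ mins) =
    (x≢αx All.∷ x≢ααx All.∷ apart 0) ∷ (αx≢ααx All.∷ apart 1) ∷ apart 2 ∷ triples-unique u mins
    where
    x≢αx : x ≢ α x
    x≢αx e = α-no-fixed-point x (sym e)
    x≢ααx : x ≢ α (α x)
    x≢ααx e = α-no-2-cycle x (sym e)
    αx≢ααx : α x ≢ α (α x)
    αx≢ααx e = α-no-fixed-point x (sym (α-injective e))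
    apart : ∀ i → All.All (iter α i x ≢_) (triples xs)
    apart i = All.tabulate λ {z} z∈ αⁱx≡z →
      let y , y∈xs , i′ , _ , αⁱ′y≡z = ∈-triples⁻ xs z∈ in
      All.lookup x∉xs y∈xs (cycleMins-meet i i′ min-x (All.lookup mins y∈xs) (trans αⁱx≡z (sym αⁱ′y≡z)))

  3*length≤countFin : ∀ {xs} → Unique xs → All.All (λ x → isCycleMin x ≡ true) xs → (C : Fin N → Bool) →
                      (∀ {x} → x ∈ xs → ∀ i → i < 3 → C (iter α i x) ≡ true) → length xs * 3 ≤ countFin C
  3*length≤countFin {xs} u mins C covers = subst (_≤ countFin C) (length-triples xs)
    (unique-⊆⇒length≤ (triples-unique u mins) triples⊆C)
    where
    triples⊆C : ∀ {z} → z ∈ triples xs → z ∈ filter (λ x → C x Bool.≟ true) (allFin N)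
    triples⊆C {z} z∈ with x , x∈xs , i , i<3 , refl ← ∈-triples⁻ xs z∈ =
      ∈.∈-filter⁺ _ (∈-allFin z) (covers x∈xs i i<3)

  cycleMins : List (Fin N)
  cycleMins = filter (λ x → isCycleMin x Bool.≟ true) (allFin N)

  cycleMins-unique : Unique cycleMins
  cycleMins-unique = Unique.filter⁺ _ (Unique.allFin⁺ N)

  cycleMins-min : All.All (λ x → isCycleMin x ≡ true) cycleMins
  cycleMins-min = All.tabulate λ x∈ → proj₂ (∈.∈-filter⁻ (λ x → isCycleMin x Bool.≟ true) {xs = allFin N} x∈)

  3*cycles≤N : length cycleMins * 3 ≤ N
  3*cycles≤N = ≤-trans (3*length≤countFin cycleMins-unique cycleMins-min (λ _ → true) (λ _ _ _ → refl))
                       (countFin≤N (λ _ → true))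

  onCycles : List (Fin N) → Fin N → Bool
  onCycles xs y = BL.any (λ x → BL.any (λ k → iter α k x =ᶠ y) (upTo N)) xs

  onCycles⁻ : ∀ xs {y} → onCycles xs y ≡ true → Σ (Fin N) λ x → x ∈ xs × Σ ℕ λ k → iter α k x ≡ y
  onCycles⁻ xs h with x , x∈xs , h′ ← any-true⁻ _ {xs} h with k , _ , αᵏx=y ← any-true⁻ _ {upTo N} h′ =
    x , x∈xs , k , =ᶠ⇒≡ αᵏx=y

  onCycles⁺ : ∀ xs {x y} k → x ∈ xs → iter α k x ≡ y → onCycles xs y ≡ true
  onCycles⁺ xs k x∈xs αᵏx≡y with k′ , k′<N , αᵏ′x≡αᵏx ← iter-below-N k _ =
    any-true⁺ _ x∈xs (any-true⁺ _ (∈.∈-upTo⁺ k′<N) (≡⇒=ᶠ (trans αᵏ′x≡αᵏx αᵏx≡y)))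

  module _ (T : Fin N → Bool) (α-closed : ∀ {z} → T z ≡ true → T (α z) ≡ true) where
    minsIn : List (Fin N)
    minsIn = filter (λ x → T x Bool.≟ true) cycleMins

    minsIn⁻ : ∀ {x} → x ∈ minsIn → x ∈ cycleMins × T x ≡ true
    minsIn⁻ = ∈.∈-filter⁻ (λ x → T x Bool.≟ true) {xs = cycleMins}

    cycleMin∈minsIn : ∀ {y} → T y ≡ true → CycleMin.min (cycleMin y) ∈ minsIn
    cycleMin∈minsIn {y} Ty = ∈.∈-filter⁺ _ (∈.∈-filter⁺ _ (∈-allFin min) isMin)
      (subst (λ t → T t ≡ true) reaches (iter-closed α T α-closed j Ty))
      where open CycleMin (cycleMin y)

    onCycles-minsIn : ∀ y → onCycles minsIn y ≡ T y
    onCycles-minsIn y with T y in Ty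
    ... | true  = onCycles⁺ minsIn k (cycleMin∈minsIn Ty) returns
      where open CycleMin (cycleMin y)
    ... | false with onCycles minsIn y in on
    ...   | false = refl
    ...   | true with x , x∈ , k , refl ← onCycles⁻ minsIn on =
      ⊥-elim (true≢false (iter-closed α T α-closed k (proj₂ (minsIn⁻ x∈))) Ty)

    minsIn-nonempty : ∀ {y} → T y ≡ true → 1 ≤ length minsIn
    minsIn-nonempty Ty = nonempty (cycleMin∈minsIn Ty)
      where
      nonempty : ∀ {x : Fin N} {xs} → x ∈ xs → 1 ≤ length xs
      nonempty (here _)  = s≤s z≤n
      nonempty (there _) = s≤s z≤n

    3*minsIn≤ : length minsIn * 3 ≤ countFin (onCycles minsIn)
    3*minsIn≤ = 3*length≤countFin (Unique.filter⁺ _ cycleMins-unique)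
      (All.tabulate λ x∈ → All.lookup cycleMins-min (proj₁ (minsIn⁻ x∈)))
      (onCycles minsIn) (λ x∈ i _ → onCycles⁺ minsIn i x∈ refl)

-- Estimates with double factorials and binomial coefficients

oddFactorial : ℕ → ℕ
oddFactorial zero    = 1
oddFactorial (suc v) = suc (2 * v) * oddFactorial v

oddFactorial-pos : ∀ v → 0 < oddFactorial v
oddFactorial-pos zero    = s≤s z≤n
oddFactorial-pos (suc v) = *-mono-≤ {1} {suc (2 * v)} (s≤s z≤n) (oddFactorial-pos v)

matchings-even : ∀ v → matchings (2 * v) ≡ oddFactorial v
matchings-even zero    = refl
matchings-even (suc v) = trans (cong matchings (*-suc 2 v)) (cong (suc (2 * v) *_) (matchings-even v))

matchings-odd : ∀ v → matchings (suc (2 * v)) ≡ 0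
matchings-odd zero    = refl
matchings-odd (suc v) = trans (cong (matchings ∘ suc) (*-suc 2 v))
                               (trans (cong (suc (suc (2 * v)) *_) (matchings-odd v)) (*-zeroʳ (suc (suc (2 * v)))))

even-or-odd : ∀ m → Σ ℕ λ v → m ≡ 2 * v ⊎ m ≡ suc (2 * v)
even-or-odd zero = 0 , inj₁ refl
even-or-odd (suc m) with even-or-odd m
... | v , inj₁ refl = v , inj₂ refl
... | v , inj₂ refl = suc v , inj₁ (sym (*-suc 2 v))

-- ⌈3t/2⌉: a union of t cycles of length ≥ 3 has at least 3t points, and an even
-- number of them when a fixed-point-free involution preserves it.
ceil3/2 : ℕ → ℕ
ceil3/2 zero          = 0
ceil3/2 (suc zero)    = 2
ceil3/2 (suc (suc t)) = 3 + ceil3/2 t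

2*ceil3/2≤1+3t : ∀ t → 2 * ceil3/2 t ≤ suc (3 * t)
2*ceil3/2≤1+3t zero          = z≤n
2*ceil3/2≤1+3t (suc zero)    = ≤ᵇ⇒≤ 4 4 _
2*ceil3/2≤1+3t (suc (suc t)) = subst₂ _≤_ (sym (lhs (ceil3/2 t))) (sym (rhs t)) (+-monoʳ-≤ 6 (2*ceil3/2≤1+3t t))
  where
  lhs : ∀ u → 2 * (3 + u) ≡ 6 + 2 * u
  lhs = solve 1 (λ u → con 2 :* (con 3 :+ u) := con 6 :+ con 2 :* u) refl
  rhs : ∀ t → suc (3 * suc (suc t)) ≡ 6 + suc (3 * t)
  rhs = solve 1 (λ t → con 1 :+ con 3 :* (con 2 :+ t) := con 6 :+ (con 1 :+ con 3 :* t)) refl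

ceil3/2-pos : ∀ {t} → 1 ≤ t → 1 ≤ ceil3/2 t
ceil3/2-pos {suc zero}    _ = s≤s z≤n
ceil3/2-pos {suc (suc t)} _ = s≤s z≤n

-- The number of fixed-point-free involutions of [2h] preserving a given 2v-element set.
matchingsSplit : ℕ → ℕ → ℕ
matchingsSplit h v = oddFactorial v * oddFactorial (h ∸ v)

matchingsSplit-suc : ∀ h v → 2 * suc v ≤ h → matchingsSplit h (suc v) ≤ matchingsSplit h v
matchingsSplit-suc h v 2[1+v]≤h = begin
  suc (2 * v) * oddFactorial v * oddFactorial w
    ≤⟨ *-monoˡ-≤ (oddFactorial w) (*-monoˡ-≤ (oddFactorial v) (s≤s (*-monoʳ-≤ 2 v≤w))) ⟩
  suc (2 * w) * oddFactorial v * oddFactorial w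
    ≡⟨ solve 3 (λ a b c → a :* b :* c := b :* (a :* c)) refl (suc (2 * w)) (oddFactorial v) (oddFactorial w) ⟩
  oddFactorial v * oddFactorial (suc w)
    ≡⟨ cong (λ x → oddFactorial v * oddFactorial x) (+-∸-assoc 1 (m+n≤o⇒n≤o v v+[1+v]≤h)) ⟨
  matchingsSplit h v ∎
  where
  open ≤-Reasoning
  w = h ∸ suc v
  v+[1+v]≤h : v + suc v ≤ h
  v+[1+v]≤h = ≤-trans (n≤1+n _) (≤-trans (≤-reflexive 1+[v+[1+v]]≡2[1+v]) 2[1+v]≤h)
    where
    1+[v+[1+v]]≡2[1+v] : suc (v + suc v) ≡ 2 * suc v
    1+[v+[1+v]]≡2[1+v] = solve 1 (λ v → con 1 :+ (v :+ (con 1 :+ v)) := con 2 :* (con 1 :+ v)) refl v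
  v≤w : v ≤ w
  v≤w = m+n≤o⇒m≤o∸n v v+[1+v]≤h

matchingsSplit-antitone : ∀ h {a b} → a ≤ b → 2 * b ≤ h → matchingsSplit h b ≤ matchingsSplit h a
matchingsSplit-antitone h {a} a≤b 2b≤h with k , refl ← m≤n⇒∃[o]m+o≡n a≤b = go k 2b≤h
  where
  go : ∀ k → 2 * (a + k) ≤ h → matchingsSplit h (a + k) ≤ matchingsSplit h a
  go zero    _ rewrite +-identityʳ a = ≤-refl
  go (suc k) 2[a+k+1]≤h rewrite +-suc a k =
    ≤-trans (matchingsSplit-suc h (a + k) 2[a+k+1]≤h) (go k (≤-trans (*-monoʳ-≤ 2 (n≤1+n (a + k))) 2[a+k+1]≤h))

-- For t ≥ 1, the largest value of matchingsSplit h v over 3t ≤ 2v ≤ h (0 if there is no such v).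
matchingsBound : ℕ → ℕ → ℕ
matchingsBound h zero        = 0
matchingsBound h t@(suc _) with 2 * ceil3/2 t Data.Nat.≤? h
... | yes _ = matchingsSplit h (ceil3/2 t)
... | no  _ = 0

matchingsBound-yes : ∀ h {t} → 1 ≤ t → 2 * ceil3/2 t ≤ h → matchingsBound h t ≡ matchingsSplit h (ceil3/2 t)
matchingsBound-yes h {suc t} _ fits with 2 * ceil3/2 (suc t) Data.Nat.≤? h
... | yes _       = refl
... | no  ¬fits = ⊥-elim (¬fits fits)

matchingsBound-no : ∀ h {t} → ¬ (2 * ceil3/2 t ≤ h) → matchingsBound h t ≡ 0
matchingsBound-no h {zero}  _ = refl
matchingsBound-no h {suc t} ¬fits with 2 * ceil3/2 (suc t) Data.Nat.≤? h
... | yes fits = ⊥-elim (¬fits fits)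
... | no  _    = refl

matchings*matchings≤matchingsBound : ∀ h t m → 1 ≤ t → 3 * t ≤ m → m ≤ h →
                                     matchings m * matchings (2 * h ∸ m) ≤ matchingsBound h t
matchings*matchings≤matchingsBound h t m 1≤t 3t≤m m≤h with even-or-odd m
... | v , inj₂ refl rewrite matchings-odd v = z≤n
... | v , inj₁ refl = begin
  matchings (2 * v) * matchings (2 * h ∸ 2 * v)
    ≡⟨ cong₂ _*_ (matchings-even v) (trans (cong matchings (sym (*-distribˡ-∸ 2 h v))) (matchings-even (h ∸ v))) ⟩
  matchingsSplit h v
    ≤⟨ matchingsSplit-antitone h u≤v m≤h ⟩
  matchingsSplit h (ceil3/2 t)
    ≡⟨ matchingsBound-yes h 1≤t (≤-trans (*-monoʳ-≤ 2 u≤v) m≤h) ⟨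
  matchingsBound h t ∎
  where
  open ≤-Reasoning
  u≤v : ceil3/2 t ≤ v
  u≤v = ≤-pred (*-cancelˡ-< 2 _ _ (begin-strict
    2 * ceil3/2 t    ≤⟨ 2*ceil3/2≤1+3t t ⟩
    suc (3 * t)      <⟨ s≤s (s≤s 3t≤m) ⟩
    2 + 2 * v        ≡⟨ *-suc 2 v ⟨
    2 * suc v        ∎))

C-ratio : ∀ K t → suc t * (K C suc t) ≡ (K ∸ t) * (K C t)
C-ratio zero    t       = trans (*-zeroʳ (suc t)) (sym (cong (_* (zero C t)) (0∸n≡0 t)))
C-ratio (suc K) zero    = trans (*-identityˡ _) (trans (nC1≡n (suc K)) (sym (*-identityʳ (suc K))))
C-ratio (suc K) (suc t) = begin
  suc (suc t) * (suc K C suc (suc t))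
    ≡⟨ cong (suc (suc t) *_) (nCk+nC[k+1]≡[n+1]C[k+1] K (suc t)) ⟨
  suc (suc t) * (K C suc t + (K C suc (suc t)))
    ≡⟨ *-distribˡ-+ (suc (suc t)) (K C suc t) (K C suc (suc t)) ⟩
  suc (suc t) * (K C suc t) + suc (suc t) * (K C suc (suc t))
    ≡⟨ cong (suc (suc t) * (K C suc t) +_) (C-ratio K (suc t)) ⟩
  suc (suc t) * (K C suc t) + (K ∸ suc t) * (K C suc t)
    ≡⟨ *-distribʳ-+ (K C suc t) (suc (suc t)) (K ∸ suc t) ⟨
  (suc (suc t) + (K ∸ suc t)) * (K C suc t)
    ≡⟨ shift (t Data.Nat.<? K) ⟩
  (suc t + (K ∸ t)) * (K C suc t)
    ≡⟨ *-distribʳ-+ (K C suc t) (suc t) (K ∸ t) ⟩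
  suc t * (K C suc t) + (K ∸ t) * (K C suc t)
    ≡⟨ cong (_+ (K ∸ t) * (K C suc t)) (C-ratio K t) ⟩
  (K ∸ t) * (K C t) + (K ∸ t) * (K C suc t)
    ≡⟨ *-distribˡ-+ (K ∸ t) (K C t) (K C suc t) ⟨
  (K ∸ t) * (K C t + (K C suc t))
    ≡⟨ cong ((K ∸ t) *_) (nCk+nC[k+1]≡[n+1]C[k+1] K t) ⟩
  (K ∸ t) * (suc K C suc t) ∎
  where
  open ≡-Reasoning
  shift : Dec (t < K) → (suc (suc t) + (K ∸ suc t)) * (K C suc t) ≡ (suc t + (K ∸ t)) * (K C suc t)
  shift (yes t<K) = cong (_* (K C suc t)) (trans (sym (+-suc (suc t) (K ∸ suc t))) (cong (suc t +_) (sym (+-∸-assoc 1 t<K))))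
  shift (no  t≮K) rewrite k>n⇒nCk≡0 {K} {suc t} (s≤s (≮⇒≥ t≮K)) =
    trans (*-zeroʳ (suc (suc t) + (K ∸ suc t))) (sym (*-zeroʳ (suc t + (K ∸ t))))

C-ratio₂ : ∀ K t → suc t * suc (suc t) * (K C suc (suc t)) ≡ (K ∸ t) * (K ∸ suc t) * (K C t)
C-ratio₂ K t = begin
  suc t * suc (suc t) * (K C suc (suc t))
    ≡⟨ *-assoc (suc t) (suc (suc t)) (K C suc (suc t)) ⟩
  suc t * (suc (suc t) * (K C suc (suc t)))
    ≡⟨ cong (suc t *_) (C-ratio K (suc t)) ⟩
  suc t * ((K ∸ suc t) * (K C suc t))
    ≡⟨ solve 3 (λ a b c → a :* (b :* c) := b :* (a :* c)) refl (suc t) (K ∸ suc t) (K C suc t) ⟩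
  (K ∸ suc t) * (suc t * (K C suc t))
    ≡⟨ cong ((K ∸ suc t) *_) (C-ratio K t) ⟩
  (K ∸ suc t) * ((K ∸ t) * (K C t))
    ≡⟨ solve 3 (λ a b c → a :* (b :* c) := b :* a :* c) refl (K ∸ suc t) (K ∸ t) (K C t) ⟩
  (K ∸ t) * (K ∸ suc t) * (K C t) ∎
  where open ≡-Reasoning

C*!≤^ : ∀ K t → (K C t) * t ! ≤ K ^ t
C*!≤^ K zero    = ≤-refl
C*!≤^ K (suc t) = begin
  (K C suc t) * (suc t * t !)
    ≡⟨ solve 3 (λ c s f → c :* (s :* f) := s :* c :* f) refl (K C suc t) (suc t) (t !) ⟩
  suc t * (K C suc t) * t !
    ≡⟨ cong (_* t !) (C-ratio K t) ⟩
  (K ∸ t) * (K C t) * t !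
    ≤⟨ *-monoˡ-≤ (t !) (*-monoˡ-≤ (K C t) (m∸n≤m K t)) ⟩
  K * (K C t) * t !
    ≡⟨ *-assoc K (K C t) (t !) ⟩
  K * ((K C t) * t !)
    ≤⟨ *-monoʳ-≤ K (C*!≤^ K t) ⟩
  K * K ^ t ∎
  where open ≤-Reasoning

sumBelow : ℕ → (ℕ → ℕ) → ℕ
sumBelow zero    g = 0
sumBelow (suc M) g = g 0 + sumBelow M (λ t → g (suc t))

sumBelow-+ : ∀ M f g → sumBelow M (λ t → f t + g t) ≡ sumBelow M f + sumBelow M g
sumBelow-+ zero    f g = refl
sumBelow-+ (suc M) f g rewrite sumBelow-+ M (λ t → f (suc t)) (λ t → g (suc t)) =
  solve 4 (λ a b c d → a :+ b :+ (c :+ d) := a :+ c :+ (b :+ d)) refl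
        (f 0) (g 0) (sumBelow M (λ t → f (suc t))) (sumBelow M (λ t → g (suc t)))

sumBelow-cong : ∀ M {f g} → (∀ t → f t ≡ g t) → sumBelow M f ≡ sumBelow M g
sumBelow-cong zero    f≗g = refl
sumBelow-cong (suc M) f≗g = cong₂ _+_ (f≗g 0) (sumBelow-cong M (λ t → f≗g (suc t)))

sumBelow-mono : ∀ M {f g} → (∀ t → f t ≤ g t) → sumBelow M f ≤ sumBelow M g
sumBelow-mono zero    f≤g = z≤n
sumBelow-mono (suc M) f≤g = +-mono-≤ (f≤g 0) (sumBelow-mono M (λ t → f≤g (suc t)))

sumBelow-const : ∀ M c → sumBelow M (λ _ → c) ≡ M * c
sumBelow-const zero    c = refl
sumBelow-const (suc M) c = cong (c +_) (sumBelow-const M c)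

sumBelow-suc : ∀ M g → sumBelow (suc M) g ≡ sumBelow M g + g M
sumBelow-suc zero    g = +-identityʳ (g 0)
sumBelow-suc (suc M) g rewrite sumBelow-suc M (λ t → g (suc t)) = sym (+-assoc (g 0) _ _)

sumBelow-split : ∀ M g B → (∀ j → g (3 + j) ≤ B) → sumBelow M g ≤ g 0 + (g 1 + g 2) + M * B
sumBelow-split zero                      g B g≤B = z≤n
sumBelow-split (suc zero)                g B g≤B =
  ≤-trans (+-monoʳ-≤ (g 0) z≤n) (m≤m+n (g 0 + (g 1 + g 2)) _)
sumBelow-split (suc (suc zero))          g B g≤B =
  ≤-trans (+-monoʳ-≤ (g 0) (+-monoʳ-≤ (g 1) z≤n)) (m≤m+n (g 0 + (g 1 + g 2)) _)
sumBelow-split (suc (suc (suc M)))       g B g≤B = begin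
  g 0 + (g 1 + (g 2 + sumBelow M (λ j → g (3 + j))))
    ≡⟨ solve 4 (λ a b c s → a :+ (b :+ (c :+ s)) := a :+ (b :+ c) :+ s) refl (g 0) (g 1) (g 2) _ ⟩
  g 0 + (g 1 + g 2) + sumBelow M (λ j → g (3 + j))
    ≤⟨ +-monoʳ-≤ (g 0 + (g 1 + g 2)) (sumBelow-mono M g≤B) ⟩
  g 0 + (g 1 + g 2) + sumBelow M (λ _ → B)
    ≡⟨ cong (g 0 + (g 1 + g 2) +_) (sumBelow-const M B) ⟩
  g 0 + (g 1 + g 2) + M * B
    ≤⟨ +-monoʳ-≤ (g 0 + (g 1 + g 2)) (*-monoˡ-≤ B (m≤n+m M 3)) ⟩
  g 0 + (g 1 + g 2) + (3 + M) * B ∎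
  where open ≤-Reasoning

binomialSum : ℕ → (ℕ → ℕ) → ℕ
binomialSum K f = sumBelow (suc K) (λ t → (K C t) * f t)

binomialSum-suc : ∀ K f → binomialSum (suc K) f ≡ binomialSum K f + binomialSum K (λ t → f (suc t))
binomialSum-suc K f = begin
  1 * f 0 + sumBelow (suc K) (λ t → (suc K C suc t) * f (suc t))
    ≡⟨ cong (1 * f 0 +_) (sumBelow-cong (suc K) (λ t → trans (cong (_* f (suc t)) (sym (nCk+nC[k+1]≡[n+1]C[k+1] K t)))
                                                              (*-distribʳ-+ (f (suc t)) (K C t) (K C suc t)))) ⟩
  1 * f 0 + sumBelow (suc K) (λ t → (K C t) * f (suc t) + (K C suc t) * f (suc t))
    ≡⟨ cong (1 * f 0 +_) (sumBelow-+ (suc K) (λ t → (K C t) * f (suc t)) (λ t → (K C suc t) * f (suc t))) ⟩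
  1 * f 0 + (binomialSum K (λ t → f (suc t)) + sumBelow (suc K) (λ t → (K C suc t) * f (suc t)))
    ≡⟨ cong (λ s → 1 * f 0 + (binomialSum K (λ t → f (suc t)) + s)) (sumBelow-suc K _) ⟩
  1 * f 0 + (binomialSum K (λ t → f (suc t)) + (sumBelow K (λ t → (K C suc t) * f (suc t)) + (K C suc K) * f (suc K)))
    ≡⟨ cong (λ c → 1 * f 0 + (binomialSum K (λ t → f (suc t))
                             + (sumBelow K (λ t → (K C suc t) * f (suc t)) + c * f (suc K))))
            (k>n⇒nCk≡0 {K} {suc K} ≤-refl) ⟩
  1 * f 0 + (binomialSum K (λ t → f (suc t)) + (sumBelow K (λ t → (K C suc t) * f (suc t)) + 0))
    ≡⟨ solve 3 (λ a b c → con 1 :* a :+ (b :+ (c :+ con 0)) := con 1 :* a :+ c :+ b) refl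
             (f 0) (binomialSum K (λ t → f (suc t))) (sumBelow K (λ t → (K C suc t) * f (suc t))) ⟩
  binomialSum K f + binomialSum K (λ t → f (suc t)) ∎
  where open ≡-Reasoning

sumBy-sublists : ∀ {a} {A : Set a} (f : ℕ → ℕ) (xs : List A) →
                 sumBy (λ ys → f (length ys)) (sublists xs) ≡ binomialSum (length xs) f
sumBy-sublists f []       = cong (_+ 0) (sym (*-identityˡ (f 0)))
sumBy-sublists f (x ∷ xs) = begin
  sumBy (λ ys → f (length ys)) (sublists xs ++ map (x ∷_) (sublists xs))
    ≡⟨ sumBy-++ _ (sublists xs) _ ⟩
  sumBy (λ ys → f (length ys)) (sublists xs) + sumBy (λ ys → f (length ys)) (map (x ∷_) (sublists xs))
    ≡⟨ cong₂ _+_ (sumBy-sublists f xs)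
                 (trans (sumBy-map _ (x ∷_) (sublists xs)) (sumBy-sublists (λ t → f (suc t)) xs)) ⟩
  binomialSum (length xs) f + binomialSum (length xs) (λ t → f (suc t))
    ≡⟨ binomialSum-suc (length xs) f ⟨
  binomialSum (suc (length xs)) f ∎
  where open ≡-Reasoning

^*oddFactorial≤oddFactorial : ∀ h k → 2 * k ≤ h → h ^ k * oddFactorial (h ∸ k) ≤ oddFactorial h
^*oddFactorial≤oddFactorial h zero    _    = ≤-reflexive (*-identityˡ (oddFactorial h))
^*oddFactorial≤oddFactorial h (suc k) 2k≤h = begin
  h * h ^ k * oddFactorial w
    ≡⟨ solve 3 (λ a b c → a :* b :* c := b :* (a :* c)) refl h (h ^ k) (oddFactorial w) ⟩
  h ^ k * (h * oddFactorial w)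
    ≤⟨ *-monoʳ-≤ (h ^ k) (*-monoˡ-≤ (oddFactorial w) h≤1+2w) ⟩
  h ^ k * oddFactorial (suc w)
    ≡⟨ cong (λ x → h ^ k * oddFactorial x) (+-∸-assoc 1 1+k≤h) ⟨
  h ^ k * oddFactorial (h ∸ k)
    ≤⟨ ^*oddFactorial≤oddFactorial h k (≤-trans (*-monoʳ-≤ 2 (n≤1+n k)) 2k≤h) ⟩
  oddFactorial h ∎
  where
  open ≤-Reasoning
  w = h ∸ suc k
  2[1+k]≡[1+k]+[1+k] : 2 * suc k ≡ suc k + suc k
  2[1+k]≡[1+k]+[1+k] = cong (suc k +_) (+-identityʳ (suc k))
  1+k≤w : suc k ≤ w
  1+k≤w = m+n≤o⇒m≤o∸n (suc k) (≤-trans (≤-reflexive (sym 2[1+k]≡[1+k]+[1+k])) 2k≤h)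
  1+k≤h : suc k ≤ h
  1+k≤h = m+n≤o⇒m≤o (suc k) (≤-trans (≤-reflexive (sym 2[1+k]≡[1+k]+[1+k])) 2k≤h)
  h≤1+2w : h ≤ suc (2 * w)
  h≤1+2w = begin
    h                ≡⟨ m+[n∸m]≡n 1+k≤h ⟨
    suc k + w        ≤⟨ +-monoˡ-≤ w 1+k≤w ⟩
    w + w            ≤⟨ n≤1+n (w + w) ⟩
    suc (w + w)      ≡⟨ cong (λ x → suc (w + x)) (+-identityʳ w) ⟨
    suc (2 * w)      ∎

oddCubic : ℕ → ℕ
oddCubic v = (2 * v + 1) * (2 * v + 3) * (2 * v + 5)

oddFactorial-+3 : ∀ v → oddFactorial (3 + v) ≡ oddCubic v * oddFactorial v
oddFactorial-+3 v = solve 2 (λ v o →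
  (con 1 :+ con 2 :* (con 2 :+ v)) :* ((con 1 :+ con 2 :* (con 1 :+ v)) :* ((con 1 :+ con 2 :* v) :* o))
    := (con 2 :* v :+ con 1) :* (con 2 :* v :+ con 3) :* (con 2 :* v :+ con 5) :* o) refl v (oddFactorial v)

quadratic-gap : ∀ x y → x ≤ y → (x + 1) * (x + 3) ≤ (x + 2) * (y + 2)
quadratic-gap x y x≤y = begin
  (x + 1) * (x + 3)
    ≤⟨ m≤m+n _ 1 ⟩
  (x + 1) * (x + 3) + 1
    ≡⟨ solve 1 (λ x → (x :+ con 1) :* (x :+ con 3) :+ con 1 := (x :+ con 2) :* (x :+ con 2)) refl x ⟩
  (x + 2) * (x + 2)
    ≤⟨ *-monoʳ-≤ (x + 2) (+-monoˡ-≤ 2 x≤y) ⟩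
  (x + 2) * (y + 2) ∎
  where open ≤-Reasoning

cubic-gap : ∀ y → (y + 2) * (y + 10) * (y + 13) ≤ (y + 7) * (y + 9) * (y + 11)
cubic-gap y = ≤-trans (m≤m+n _ (2 * y * y + 63 * y + 433)) (≤-reflexive (solve 1 (λ y →
  (y :+ con 2) :* (y :+ con 10) :* (y :+ con 13) :+ (con 2 :* y :* y :+ con 63 :* y :+ con 433)
    := (y :+ con 7) :* (y :+ con 9) :* (y :+ con 11)) refl y))

odd-cubic-gap : ∀ x y → x ≤ y → (y + 13) * (y + 10) * ((x + 1) * (x + 3) * (x + 5))
                              ≤ (x + 2) * (x + 5) * ((y + 7) * (y + 9) * (y + 11))
odd-cubic-gap x y x≤y = begin
  (y + 13) * (y + 10) * ((x + 1) * (x + 3) * (x + 5))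
    ≤⟨ *-monoʳ-≤ ((y + 13) * (y + 10)) (*-monoˡ-≤ (x + 5) (quadratic-gap x y x≤y)) ⟩
  (y + 13) * (y + 10) * ((x + 2) * (y + 2) * (x + 5))
    ≡⟨ solve 5 (λ a b c d e → a :* b :* (c :* d :* e) := c :* e :* (d :* b :* a)) refl
             (y + 13) (y + 10) (x + 2) (y + 2) (x + 5) ⟩
  (x + 2) * (x + 5) * ((y + 2) * (y + 10) * (y + 13))
    ≤⟨ *-monoʳ-≤ ((x + 2) * (x + 5)) (cubic-gap y) ⟩
  (x + 2) * (x + 5) * ((y + 7) * (y + 9) * (y + 11)) ∎
  where open ≤-Reasoning

-- Cleared of denominators, this is term (2 + t) ≤ term t in BinomialTail below.
binomial-cubic-step : ∀ K t u d → 2 * u ≤ suc (3 * t) → 3 * K ≤ 2 * (2 * (3 + u) + d) →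
                      (K ∸ t) * (K ∸ suc t) * oddCubic u ≤ suc t * suc (suc t) * oddCubic (3 + u + d)
binomial-cubic-step K t u d 2u≤1+3t 3K≤2h = *-cancelˡ-≤ 9 (begin
  9 * ((K ∸ t) * (K ∸ suc t) * oddCubic u)
    ≡⟨ solve 3 (λ a b c → con 9 :* (a :* b :* c) := con 3 :* a :* (con 3 :* b) :* c) refl
             (K ∸ t) (K ∸ suc t) (oddCubic u) ⟩
  3 * (K ∸ t) * (3 * (K ∸ suc t)) * ((x + 1) * (x + 3) * (x + 5))
    ≤⟨ *-monoˡ-≤ ((x + 1) * (x + 3) * (x + 5)) (*-mono-≤ first second) ⟩
  (y + 13) * (y + 10) * ((x + 1) * (x + 3) * (x + 5))
    ≤⟨ odd-cubic-gap x y (m≤m+n x (2 * d)) ⟩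
  (x + 2) * (x + 5) * ((y + 7) * (y + 9) * (y + 11))
    ≤⟨ *-monoˡ-≤ ((y + 7) * (y + 9) * (y + 11)) (*-mono-≤ x+2≤3[1+t] x+5≤3[2+t]) ⟩
  3 * suc t * (3 * suc (suc t)) * ((y + 7) * (y + 9) * (y + 11))
    ≡⟨ cong (3 * suc t * (3 * suc (suc t)) *_) oddCubic[3+u+d] ⟨
  3 * suc t * (3 * suc (suc t)) * oddCubic (3 + u + d)
    ≡⟨ solve 3 (λ a b c → con 3 :* a :* (con 3 :* b) :* c := con 9 :* (a :* b :* c)) refl
             (suc t) (suc (suc t)) (oddCubic (3 + u + d)) ⟩
  9 * (suc t * suc (suc t) * oddCubic (3 + u + d)) ∎)
  where
  open ≤-Reasoning
  x = 2 * u
  y = 2 * u + 2 * d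
  oddCubic[3+u+d] : oddCubic (3 + u + d) ≡ (y + 7) * (y + 9) * (y + 11)
  oddCubic[3+u+d] = solve 2 (λ u d →
    (con 2 :* (con 3 :+ u :+ d) :+ con 1) :* (con 2 :* (con 3 :+ u :+ d) :+ con 3) :* (con 2 :* (con 3 :+ u :+ d) :+ con 5)
      := (con 2 :* u :+ con 2 :* d :+ con 7) :* (con 2 :* u :+ con 2 :* d :+ con 9)
         :* (con 2 :* u :+ con 2 :* d :+ con 11)) refl u d
  x+2≤3[1+t] : x + 2 ≤ 3 * suc t
  x+2≤3[1+t] = ≤-trans (+-monoˡ-≤ 2 2u≤1+3t)
    (≤-reflexive (solve 1 (λ t → con 1 :+ con 3 :* t :+ con 2 := con 3 :* (con 1 :+ t)) refl t))
  x+5≤3[2+t] : x + 5 ≤ 3 * suc (suc t)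
  x+5≤3[2+t] = ≤-trans (+-monoˡ-≤ 5 2u≤1+3t)
    (≤-reflexive (solve 1 (λ t → con 1 :+ con 3 :* t :+ con 5 := con 3 :* (con 2 :+ t)) refl t))
  2h≤3t+y+13 : 2 * (2 * (3 + u) + d) ≤ 3 * t + (y + 13)
  2h≤3t+y+13 = begin
    2 * (2 * (3 + u) + d)
      ≡⟨ solve 2 (λ u d → con 2 :* (con 2 :* (con 3 :+ u) :+ d)
                       := con 2 :* u :+ (con 2 :* u :+ con 2 :* d :+ con 12)) refl u d ⟩
    2 * u + (y + 12)
      ≤⟨ +-monoˡ-≤ (y + 12) 2u≤1+3t ⟩
    suc (3 * t) + (y + 12)
      ≡⟨ solve 2 (λ t y → con 1 :+ con 3 :* t :+ (y :+ con 12) := con 3 :* t :+ (y :+ con 13)) refl t y ⟩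
    3 * t + (y + 13) ∎
  first : 3 * (K ∸ t) ≤ y + 13
  first = begin
    3 * (K ∸ t)                      ≡⟨ *-distribˡ-∸ 3 K t ⟩
    3 * K ∸ 3 * t                    ≤⟨ ∸-monoˡ-≤ (3 * t) 3K≤2h ⟩
    2 * (2 * (3 + u) + d) ∸ 3 * t    ≤⟨ m≤n+o⇒m∸n≤o _ (3 * t) 2h≤3t+y+13 ⟩
    y + 13                           ∎
  second : 3 * (K ∸ suc t) ≤ y + 10
  second = begin
    3 * (K ∸ suc t)
      ≡⟨ *-distribˡ-∸ 3 K (suc t) ⟩
    3 * K ∸ 3 * suc t
      ≤⟨ ∸-monoˡ-≤ (3 * suc t) 3K≤2h ⟩
    2 * (2 * (3 + u) + d) ∸ 3 * suc t
      ≤⟨ m≤n+o⇒m∸n≤o _ (3 * suc t) (≤-trans 2h≤3t+y+13 (≤-reflexive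
                                              (solve 2 (λ t y → con 3 :* t :+ (y :+ con 13) := con 3 :* (con 1 :+ t) :+ (y :+ con 10)) refl t y))) ⟩
    y + 10 ∎

C*oddFactorials-step : ∀ K t u m → (K ∸ t) * (K ∸ suc t) * oddCubic u ≤ suc t * suc (suc t) * oddCubic m →
                       (K C (2 + t)) * (oddFactorial (3 + u) * oddFactorial m)
                         ≤ (K C t) * (oddFactorial u * oddFactorial (3 + m))
C*oddFactorials-step K t u m step = *-cancelˡ-≤ p (begin
  p * ((K C (2 + t)) * (oddFactorial (3 + u) * oddFactorial m))
    ≡⟨ cong (λ a → p * ((K C (2 + t)) * (a * oddFactorial m))) (oddFactorial-+3 u) ⟩
  p * ((K C (2 + t)) * (oddCubic u * oddFactorial u * oddFactorial m))
    ≡⟨ solve 5 (λ p c q a b → p :* (c :* (q :* a :* b)) := p :* c :* q :* (a :* b)) refl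
             p (K C (2 + t)) (oddCubic u) (oddFactorial u) (oddFactorial m) ⟩
  p * (K C (2 + t)) * oddCubic u * (oddFactorial u * oddFactorial m)
    ≡⟨ cong (λ w → w * oddCubic u * (oddFactorial u * oddFactorial m)) (C-ratio₂ K t) ⟩
  (K ∸ t) * (K ∸ suc t) * (K C t) * oddCubic u * (oddFactorial u * oddFactorial m)
    ≡⟨ solve 6 (λ a b c q x y → a :* b :* c :* q :* (x :* y) := a :* b :* q :* (c :* x :* y)) refl
             (K ∸ t) (K ∸ suc t) (K C t) (oddCubic u) (oddFactorial u) (oddFactorial m) ⟩
  (K ∸ t) * (K ∸ suc t) * oddCubic u * ((K C t) * oddFactorial u * oddFactorial m)
    ≤⟨ *-monoˡ-≤ ((K C t) * oddFactorial u * oddFactorial m) step ⟩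
  p * oddCubic m * ((K C t) * oddFactorial u * oddFactorial m)
    ≡⟨ solve 5 (λ p q c x y → p :* q :* (c :* x :* y) := p :* (c :* (x :* (q :* y)))) refl
             p (oddCubic m) (K C t) (oddFactorial u) (oddFactorial m) ⟩
  p * ((K C t) * (oddFactorial u * (oddCubic m * oddFactorial m)))
    ≡⟨ cong (λ a → p * ((K C t) * (oddFactorial u * a))) (oddFactorial-+3 m) ⟨
  p * ((K C t) * (oddFactorial u * oddFactorial (3 + m))) ∎)
  where
  open ≤-Reasoning
  p = suc t * suc (suc t)

^-distribʳ-* : ∀ m n t → (m * n) ^ t ≡ m ^ t * n ^ t
^-distribʳ-* m n zero    = refl
^-distribʳ-* m n (suc t) = trans (cong (m * n *_) (^-distribʳ-* m n t))
  (solve 4 (λ m n a b → m :* n :* (a :* b) := m :* a :* (n :* b)) refl m n (m ^ t) (n ^ t))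

module BinomialTail (h K : ℕ) (3K≤2h : 3 * K ≤ 2 * h) where
  term : ℕ → ℕ
  term t = (K C t) * matchingsBound h t

  term-unfits : ∀ {t} → ¬ (2 * ceil3/2 t ≤ h) → term t ≡ 0
  term-unfits {t} ¬fits = trans (cong ((K C t) *_) (matchingsBound-no h {t} ¬fits)) (*-zeroʳ (K C t))

  -- Uses t! (K C t) ≤ Kᵗ, 3K ≤ 2h, and hⁱ (2(h - i) - 1)!! ≤ (2h - 1)!! for 2i ≤ h.
  term-bound : ∀ t s q → 1 ≤ t → t + s ≤ ceil3/2 t →
               2 ^ t * oddFactorial (ceil3/2 t) ≤ q * (t ! * 3 ^ t) → h ^ s * term t ≤ q * oddFactorial h
  term-bound t s q 1≤t t+s≤u coefficient with 2 * ceil3/2 t Data.Nat.≤? h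
  ... | no ¬fits = ≤-trans (≤-reflexive (trans (cong (h ^ s *_) (term-unfits {t} ¬fits)) (*-zeroʳ (h ^ s)))) z≤n
  ... | yes fits = *-cancelʳ-≤ (h ^ s * term t) (q * oddFactorial h) (t ! * 3 ^ t)
                                {{m*n≢0 (t !) (3 ^ t) {{t !≢0}} {{m^n≢0 3 t}}}} (begin
    h ^ s * ((K C t) * matchingsBound h t) * (t ! * 3 ^ t)
      ≡⟨ cong (λ w → h ^ s * ((K C t) * w) * (t ! * 3 ^ t)) (matchingsBound-yes h {t} 1≤t fits) ⟩
    h ^ s * ((K C t) * (ou * ohu)) * (t ! * 3 ^ t)
      ≡⟨ solve 6 (λ hs c ou ohu f p → hs :* (c :* (ou :* ohu)) :* (f :* p) := p :* (c :* f) :* (hs :* (ou :* ohu))) refl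
               (h ^ s) (K C t) ou ohu (t !) (3 ^ t) ⟩
    3 ^ t * ((K C t) * t !) * (h ^ s * (ou * ohu))
      ≤⟨ *-monoˡ-≤ (h ^ s * (ou * ohu)) (*-monoʳ-≤ (3 ^ t) (C*!≤^ K t)) ⟩
    3 ^ t * K ^ t * (h ^ s * (ou * ohu))
      ≡⟨ cong (_* (h ^ s * (ou * ohu))) (^-distribʳ-* 3 K t) ⟨
    (3 * K) ^ t * (h ^ s * (ou * ohu))
      ≤⟨ *-monoˡ-≤ (h ^ s * (ou * ohu)) (^-monoˡ-≤ t 3K≤2h) ⟩
    (2 * h) ^ t * (h ^ s * (ou * ohu))
      ≡⟨ cong (_* (h ^ s * (ou * ohu))) (^-distribʳ-* 2 h t) ⟩
    2 ^ t * h ^ t * (h ^ s * (ou * ohu))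
      ≡⟨ solve 5 (λ p ht hs ou ohu → p :* ht :* (hs :* (ou :* ohu)) := p :* ou :* (ht :* hs :* ohu)) refl
               (2 ^ t) (h ^ t) (h ^ s) ou ohu ⟩
    2 ^ t * ou * (h ^ t * h ^ s * ohu)
      ≡⟨ cong (λ w → 2 ^ t * ou * (w * ohu)) (^-distribˡ-+-* h t s) ⟨
    2 ^ t * ou * (h ^ (t + s) * ohu)
      ≤⟨ *-monoʳ-≤ (2 ^ t * ou) (*-monoˡ-≤ ohu (^-monoʳ-≤ h {{h≢0}} t+s≤u)) ⟩
    2 ^ t * ou * (h ^ ceil3/2 t * ohu)
      ≤⟨ *-monoʳ-≤ (2 ^ t * ou) (^*oddFactorial≤oddFactorial h (ceil3/2 t) fits) ⟩
    2 ^ t * ou * oddFactorial h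
      ≤⟨ *-monoˡ-≤ (oddFactorial h) coefficient ⟩
    q * (t ! * 3 ^ t) * oddFactorial h
      ≡⟨ solve 3 (λ q c o → q :* c :* o := q :* o :* c) refl q (t ! * 3 ^ t) (oddFactorial h) ⟩
    q * oddFactorial h * (t ! * 3 ^ t) ∎)
    where
    open ≤-Reasoning
    ou  = oddFactorial (ceil3/2 t)
    ohu = oddFactorial (h ∸ ceil3/2 t)
    h≢0 : NonZero h
    h≢0 = >-nonZero (≤-trans (≤-trans (ceil3/2-pos 1≤t) (m≤m+n _ _)) fits)

  term₁ : h ^ 1 * term 1 ≤ 2 * oddFactorial h
  term₁ = term-bound 1 1 2 (s≤s z≤n) ≤-refl (≤ᵇ⇒≤ _ _ _)

  term₂ : h ^ 1 * term 2 ≤ 4 * oddFactorial h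
  term₂ = term-bound 2 1 4 (s≤s z≤n) ≤-refl (≤ᵇ⇒≤ _ _ _)

  term₃ : h ^ 2 * term 3 ≤ 47 * oddFactorial h
  term₃ = term-bound 3 2 47 (s≤s z≤n) ≤-refl (≤ᵇ⇒≤ _ _ _)

  term₄ : h ^ 2 * term 4 ≤ 86 * oddFactorial h
  term₄ = term-bound 4 2 86 (s≤s z≤n) ≤-refl (≤ᵇ⇒≤ _ _ _)

  term-+2 : ∀ t → 1 ≤ t → term (2 + t) ≤ term t
  term-+2 t 1≤t = by-cases (2 * ceil3/2 (2 + t) Data.Nat.≤? h)
    where
    u = ceil3/2 t
    by-cases : Dec (2 * ceil3/2 (2 + t) ≤ h) → term (2 + t) ≤ term t
    by-cases (no ¬fits) = ≤-trans (≤-reflexive (term-unfits {2 + t} ¬fits)) z≤n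
    by-cases (yes fits) with d , 2[3+u]+d≡h ← m≤n⇒∃[o]m+o≡n fits = begin
      (K C (2 + t)) * matchingsBound h (2 + t)
        ≡⟨ cong ((K C (2 + t)) *_) (matchingsBound-yes h {2 + t} (s≤s z≤n) fits) ⟩
      (K C (2 + t)) * (oddFactorial (3 + u) * oddFactorial (h ∸ (3 + u)))
        ≡⟨ cong (λ w → (K C (2 + t)) * (oddFactorial (3 + u) * oddFactorial w)) h∸[3+u]≡m ⟩
      (K C (2 + t)) * (oddFactorial (3 + u) * oddFactorial m)
        ≤⟨ C*oddFactorials-step K t u m (binomial-cubic-step K t u d (2*ceil3/2≤1+3t t) 3K≤2[2[3+u]+d]) ⟩
      (K C t) * (oddFactorial u * oddFactorial (3 + m))
        ≡⟨ cong (λ w → (K C t) * (oddFactorial u * oddFactorial w)) h∸u≡3+m ⟨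
      (K C t) * matchingsSplit h u
        ≡⟨ cong ((K C t) *_) (matchingsBound-yes h {t} 1≤t (≤-trans (*-monoʳ-≤ 2 (m≤n+m u 3)) fits)) ⟨
      term t ∎
      where
      open ≤-Reasoning
      m = 3 + u + d
      h≡[3+u]+m : h ≡ (3 + u) + m
      h≡[3+u]+m = trans (sym 2[3+u]+d≡h)
        (solve 2 (λ u d → con 2 :* (con 3 :+ u) :+ d := (con 3 :+ u) :+ (con 3 :+ u :+ d)) refl u d)
      h∸[3+u]≡m : h ∸ (3 + u) ≡ m
      h∸[3+u]≡m = trans (cong (_∸ (3 + u)) h≡[3+u]+m) (m+n∸m≡n (3 + u) m)
      h∸u≡3+m : h ∸ u ≡ 3 + m
      h∸u≡3+m = trans (cong (_∸ u) (trans h≡[3+u]+m (solve 2 (λ u m → con 3 :+ u :+ m := u :+ (con 3 :+ m)) refl u m)))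
                      (m+n∸m≡n u (3 + m))
      3K≤2[2[3+u]+d] : 3 * K ≤ 2 * (2 * (3 + u) + d)
      3K≤2[2[3+u]+d] = subst (λ x → 3 * K ≤ 2 * x) (sym 2[3+u]+d≡h) 3K≤2h

  term-tail : ∀ j → term (3 + j) ≤ term 3 + term 4
  term-tail zero          = m≤m+n (term 3) (term 4)
  term-tail (suc zero)    = m≤n+m (term 4) (term 3)
  term-tail (suc (suc j)) = ≤-trans (term-+2 (3 + j) (s≤s z≤n)) (term-tail j)

  h*binomialSum≤ : h * binomialSum K (matchingsBound h) ≤ 139 * oddFactorial h
  h*binomialSum≤ with 0 Data.Nat.<? h
  ... | no  h≯0 = ≤-trans (≤-reflexive (cong (_* binomialSum K (matchingsBound h)) (n≤0⇒n≡0 (≮⇒≥ h≯0)))) z≤n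
  ... | yes h>0 = begin
    h * sumBelow (suc K) term
      ≤⟨ *-monoʳ-≤ h (sumBelow-split (suc K) term (term 3 + term 4) term-tail) ⟩
    h * (term 0 + (term 1 + term 2) + suc K * (term 3 + term 4))
      ≡⟨ cong (λ z → h * (z + (term 1 + term 2) + suc K * (term 3 + term 4))) (*-zeroʳ (K C 0)) ⟩
    h * (term 1 + term 2 + suc K * (term 3 + term 4))
      ≤⟨ *-monoʳ-≤ h (+-monoʳ-≤ (term 1 + term 2) (*-monoˡ-≤ (term 3 + term 4) 1+K≤h)) ⟩
    h * (term 1 + term 2 + h * (term 3 + term 4))
      ≡⟨ solve 5 (λ h a b c d → h :* (a :+ b :+ h :* (c :+ d))
                              := h :* con 1 :* a :+ h :* con 1 :* b :+ (h :* (h :* con 1) :* c :+ h :* (h :* con 1) :* d))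
               refl h (term 1) (term 2) (term 3) (term 4) ⟩
    h ^ 1 * term 1 + h ^ 1 * term 2 + (h ^ 2 * term 3 + h ^ 2 * term 4)
      ≤⟨ +-mono-≤ (+-mono-≤ term₁ term₂) (+-mono-≤ term₃ term₄) ⟩
    2 * oddFactorial h + 4 * oddFactorial h + (47 * oddFactorial h + 86 * oddFactorial h)
      ≡⟨ solve 1 (λ o → con 2 :* o :+ con 4 :* o :+ (con 47 :* o :+ con 86 :* o) := con 139 :* o) refl (oddFactorial h) ⟩
    139 * oddFactorial h ∎
    where
    open ≤-Reasoning
    1+K≤h : suc K ≤ h
    1+K≤h = ≰⇒> λ h≤K → <-irrefl refl (begin-strict
      2 * h      <⟨ *-monoˡ-< h {{>-nonZero h>0}} {2} {3} ≤-refl ⟩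
      3 * h      ≤⟨ *-monoʳ-≤ 3 h≤K ⟩
      3 * K      ≤⟨ 3K≤2h ⟩
      2 * h      ∎)

-- Counting the pairs with several orbits

countMaps-∧ : ∀ {N} (c : Bool) (P : Map N → Bool) → countMaps (λ β → c ∧ P β) ≡ indicator c * countMaps P
countMaps-∧ true  P = sym (+-identityʳ (countMaps P))
countMaps-∧ {N} false P = count-none (λ β → false ∧ P β) (allMaps N) (λ _ → refl)

disconnecting : ∀ {N} → Map N → Map N → Bool
disconnecting {N} α β = inClass2 N β ∧ not (numOrbits N α β =ⁿ 1)

module Disconnection {N : ℕ} (h : ℕ) (N≡2h : N ≡ 2 * h) (α : Map N)
                     (α-injective : ∀ {x y} → α x ≡ α y → x ≡ y)
                     (α-no-fixed-point : ∀ x → α x ≢ x) (α-no-2-cycle : ∀ x → α (α x) ≢ x) where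
  open Cycles α α-injective
  open CycleSets α α-injective α-no-fixed-point α-no-2-cycle

  admissible : List (Fin N) → Bool
  admissible R = ⌊ 1 Data.Nat.≤? length R ⌋ ∧ ⌊ countFin (onCycles R) * 2 Data.Nat.≤? N ⌋
               ∧ ⌊ length R * 3 Data.Nat.≤? countFin (onCycles R) ⌋

  admissible⁺ : ∀ R → 1 ≤ length R → countFin (onCycles R) * 2 ≤ N → length R * 3 ≤ countFin (onCycles R) →
                admissible R ≡ true
  admissible⁺ R nonempty small large =
    ∧-true⁺ (≤⇒⌊≤?⌋ nonempty) (∧-true⁺ (≤⇒⌊≤?⌋ small) (≤⇒⌊≤?⌋ large))

  preservesCyclesOf : List (Fin N) → Map N → Bool
  preservesCyclesOf R β = admissible R ∧ preservingInvolution (onCycles R) β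

  invariantHalf⇒preserves : ∀ {β} → inClass2 N β ≡ true → InvariantHalf α β →
                            Σ (List (Fin N)) λ R → R ∈ sublists cycleMins × preservesCyclesOf R β ≡ true
  invariantHalf⇒preserves {β} class2 half =
    R , filter∈sublists T cycleMins , ∧-true⁺ admissible-R (∧-true⁺ class2 preserves-R)
    where
    open InvariantHalf half
    R = minsIn T α-closed
    R≗T : ∀ y → onCycles R y ≡ T y
    R≗T = onCycles-minsIn T α-closed
    admissible-R : admissible R ≡ true
    admissible-R with y , Ty ← countFin-pos T nonempty = admissible⁺ R (minsIn-nonempty T α-closed Ty)
      (subst (λ c → c * 2 ≤ N) (sym (countFin-cong R≗T)) atMostHalf) (3*minsIn≤ T α-closed)
    preserves-R : preserves (onCycles R) β ≡ true
    preserves-R = allB-true⁺ _ λ y → into y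
      where
      into : ∀ y → (not (onCycles R y) ∨ onCycles R (β y)) ≡ true
      into y with T y in Ty
      ... | false = ∨-trueˡ (not-true⁺ (trans (R≗T y) Ty))
      ... | true  = ∨-trueʳ {not (onCycles R y)} (trans (R≗T (β y)) (β-closed Ty))

  disconnecting⇒preserves : ∀ {β} → 0 < N → disconnecting α β ≡ true →
                            Σ (List (Fin N)) λ R → R ∈ sublists cycleMins × preservesCyclesOf R β ≡ true
  disconnecting⇒preserves {β} 0<N disc =
    invariantHalf⇒preserves class2 (invariantHalf α β β-invol α-periodic 0<N numOrbits≢1)
    where
    class2 = proj₁ (∧-true⁻ disc)
    numOrbits≢1 : numOrbits N α β ≢ 1
    numOrbits≢1 e = true≢false (proj₂ (∧-true⁻ {inClass2 N β} disc)) (cong not (≡⇒=ⁿ e))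
    β-invol : ∀ z → β (β z) ≡ z
    β-invol z = =ᶠ⇒≡ (proj₁ (∧-true⁻ (allB-true⁻ _ (proj₂ (∧-true⁻ {isPerm β} class2)) z)))
    α-periodic : ∀ z → Σ ℕ λ L → iter α (suc L) z ≡ z
    α-periodic z = proj₁ (period z) , proj₂ (proj₂ (period z))

  preservesCyclesOf-bound : ∀ R → countMaps (preservesCyclesOf R) * matchings N ≤ matchingsBound h (length R) * sizeClass2 N
  preservesCyclesOf-bound R =
    ≤-trans (≤-reflexive (cong (_* matchings N) (countMaps-∧ (admissible R) (preservingInvolution (onCycles R)))))
            by-admissibility
    where
    m = countFin (onCycles R)
    by-admissibility : indicator (admissible R) * countMaps (preservingInvolution (onCycles R)) * matchings N
                     ≤ matchingsBound h (length R) * sizeClass2 N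
    by-admissibility with admissible R in adm
    ... | false = z≤n
    ... | true with ∧-true⁻ adm
    ...   | 1≤|R| , adm′ with ∧-true⁻ adm′
    ...     | 2m≤N , |R|*3≤m = begin
      (countMaps (preservingInvolution (onCycles R)) + 0) * matchings N
        ≡⟨ cong (_* matchings N) (+-identityʳ (countMaps (preservingInvolution (onCycles R)))) ⟩
      countMaps (preservingInvolution (onCycles R)) * matchings N
        ≡⟨ preservingInvolutions-ratio (onCycles R) ⟩
      matchings m * matchings (N ∸ m) * sizeClass2 N
        ≡⟨ cong (λ n → matchings m * matchings (n ∸ m) * sizeClass2 N) N≡2h ⟩
      matchings m * matchings (2 * h ∸ m) * sizeClass2 N
        ≤⟨ *-monoˡ-≤ (sizeClass2 N)
             (matchings*matchings≤matchingsBound h (length R) m (⌊≤?⌋⇒≤ 1≤|R|) 3|R|≤m m≤h) ⟩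
      matchingsBound h (length R) * sizeClass2 N ∎
      where
      open ≤-Reasoning
      3|R|≤m : 3 * length R ≤ m
      3|R|≤m = ≤-trans (≤-reflexive (*-comm 3 (length R))) (⌊≤?⌋⇒≤ |R|*3≤m)
      m≤h : m ≤ h
      m≤h = *-cancelʳ-≤ m h 2 (≤-trans (⌊≤?⌋⇒≤ 2m≤N) (≤-reflexive (trans N≡2h (*-comm 2 h))))

  union-bound : 0 < N → countMaps (disconnecting α) ≤ sumBy (λ R → countMaps (preservesCyclesOf R)) (sublists cycleMins)
  union-bound 0<N = count-union (disconnecting α) preservesCyclesOf (sublists cycleMins) (allMaps N)
                                (λ _ → disconnecting⇒preserves 0<N)

  h*disconnecting≤ : 0 < N → h * countMaps (disconnecting α) ≤ 139 * sizeClass2 N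
  h*disconnecting≤ 0<N =
    *-cancelʳ-≤ (h * countMaps (disconnecting α)) (139 * sizeClass2 N) (matchings N) {{matchingsN≢0}} (begin
    h * countMaps (disconnecting α) * matchings N
      ≡⟨ *-assoc h _ (matchings N) ⟩
    h * (countMaps (disconnecting α) * matchings N)
      ≤⟨ *-monoʳ-≤ h (*-monoˡ-≤ (matchings N) (union-bound 0<N)) ⟩
    h * (sumBy (λ R → countMaps (preservesCyclesOf R)) (sublists cycleMins) * matchings N)
      ≡⟨ cong (h *_) (sumBy-*ʳ (λ R → countMaps (preservesCyclesOf R)) (matchings N) (sublists cycleMins)) ⟨
    h * sumBy (λ R → countMaps (preservesCyclesOf R) * matchings N) (sublists cycleMins)
      ≤⟨ *-monoʳ-≤ h (sumBy-mono _ _ (sublists cycleMins) (λ {R} _ → preservesCyclesOf-bound R)) ⟩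
    h * sumBy (λ R → matchingsBound h (length R) * sizeClass2 N) (sublists cycleMins)
      ≡⟨ cong (h *_) (sumBy-*ʳ (λ R → matchingsBound h (length R)) (sizeClass2 N) (sublists cycleMins)) ⟩
    h * (sumBy (λ R → matchingsBound h (length R)) (sublists cycleMins) * sizeClass2 N)
      ≡⟨ cong (λ s → h * (s * sizeClass2 N)) (sumBy-sublists (matchingsBound h) cycleMins) ⟩
    h * (binomialSum (length cycleMins) (matchingsBound h) * sizeClass2 N)
      ≡⟨ *-assoc h _ (sizeClass2 N) ⟨
    h * binomialSum (length cycleMins) (matchingsBound h) * sizeClass2 N
      ≤⟨ *-monoˡ-≤ (sizeClass2 N) (BinomialTail.h*binomialSum≤ h (length cycleMins) 3K≤2h) ⟩
    139 * oddFactorial h * sizeClass2 N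
      ≡⟨ solve 3 (λ a b c → a :* b :* c := a :* c :* b) refl 139 (oddFactorial h) (sizeClass2 N) ⟩
    139 * sizeClass2 N * oddFactorial h
      ≡⟨ cong (139 * sizeClass2 N *_) matchingsN≡ ⟨
    139 * sizeClass2 N * matchings N ∎)
    where
    open ≤-Reasoning
    matchingsN≡ : matchings N ≡ oddFactorial h
    matchingsN≡ = trans (cong matchings N≡2h) (matchings-even h)
    matchingsN≢0 : NonZero (matchings N)
    matchingsN≢0 = >-nonZero (subst (0 <_) (sym matchingsN≡) (oddFactorial-pos h))
    3K≤2h : 3 * length cycleMins ≤ 2 * h
    3K≤2h = ≤-trans (≤-reflexive (*-comm 3 (length cycleMins))) (≤-trans 3*cycles≤N (≤-reflexive N≡2h))

cycleLen-fixed : ∀ {N} (f : Map N) {x} → f x ≡ x → cycleLen f x ≡ 1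
cycleLen-fixed {suc N} f fx≡x rewrite ≡⇒=ᶠ fx≡x = refl

cycleLen-2-cycle : ∀ {N} (f : Map N) {x} → f (f x) ≡ x → f x ≢ x → cycleLen f x ≡ 2
cycleLen-2-cycle {suc zero}    f {Fin.zero} _     fx≢x with f Fin.zero
... | Fin.zero = ⊥-elim (fx≢x refl)
cycleLen-2-cycle {suc (suc N)} f ffx≡x fx≢x rewrite ≢⇒=ᶠ-false fx≢x | ≡⇒=ᶠ ffx≡x = refl

module ClassJ {N : ℕ} (n : ℕ → ℕ) (no-short-cycles : ∀ j → j < 3 → n j ≡ 0)
              (α : Map N) (α∈𝒞J : inClassJ N n α ≡ true) where
  private
    perm : isPerm α ≡ true
    perm = proj₁ (∧-true⁻ α∈𝒞J)
    cycle-allowed : ∀ x → 1 ≤ n (cycleLen α x)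
    cycle-allowed x = ⌊≤?⌋⇒≤ (allB-true⁻ _ (proj₁ (∧-true⁻ (proj₂ (∧-true⁻ {isPerm α} α∈𝒞J)))) x)
    not-of-length : ∀ {x} j → j < 3 → cycleLen α x ≢ j
    not-of-length {x} j j<3 len≡j = <⇒≢ (subst (λ l → 0 < n l) len≡j (cycle-allowed x)) (sym (no-short-cycles j j<3))

  α-injective : ∀ {x y} → α x ≡ α y → x ≡ y
  α-injective {x} {y} αx≡αy with ∨-true⁻ {not (α x =ᶠ α y)} (allB-true⁻ _ (allB-true⁻ _ perm x) y)
  ... | inj₁ αx≠αy = ⊥-elim (true≢false (≡⇒=ᶠ αx≡αy) (not-true⁻ αx≠αy))
  ... | inj₂ x=y   = =ᶠ⇒≡ x=y

  α-no-fixed-point : ∀ x → α x ≢ x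
  α-no-fixed-point x αx≡x = not-of-length 1 (s≤s (s≤s z≤n)) (cycleLen-fixed α αx≡x)

  α-no-2-cycle : ∀ x → α (α x) ≢ x
  α-no-2-cycle x ααx≡x = not-of-length 2 (s≤s (s≤s (s≤s z≤n))) (cycleLen-2-cycle α ααx≡x (α-no-fixed-point x))

badPairs≡ : ∀ N n →
            badPairs N n ≡ sumBy (λ α → countMaps (λ β → inClassJ N n α ∧ disconnecting α β)) (allMaps N)
badPairs≡ N n = count-cartesianProduct _ (allMaps N) (allMaps N)

h*badPairs≤ : ∀ N n h → N ≡ 2 * h → 0 < N → (∀ j → j < 3 → n j ≡ 0) →
              h * badPairs N n ≤ 139 * (sizeClassJ N n * sizeClass2 N)
h*badPairs≤ N n h N≡2h 0<N no-short-cycles = begin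
  h * badPairs N n
    ≡⟨ cong (h *_) (badPairs≡ N n) ⟩
  h * sumBy bad (allMaps N)
    ≡⟨ trans (*-comm h _) (sym (sumBy-*ʳ bad h (allMaps N))) ⟩
  sumBy (λ α → bad α * h) (allMaps N)
    ≤⟨ sumBy-mono _ _ (allMaps N) (λ {α} _ → per-α α) ⟩
  sumBy (λ α → indicator (inClassJ N n α) * (139 * sizeClass2 N)) (allMaps N)
    ≡⟨ sumBy-*ʳ (λ α → indicator (inClassJ N n α)) _ (allMaps N) ⟩
  sumBy (λ α → indicator (inClassJ N n α)) (allMaps N) * (139 * sizeClass2 N)
    ≡⟨ cong (_* (139 * sizeClass2 N)) (sumBy-indicator (inClassJ N n) (allMaps N)) ⟩
  sizeClassJ N n * (139 * sizeClass2 N)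
    ≡⟨ solve 2 (λ a b → a :* (con 139 :* b) := con 139 :* (a :* b)) refl (sizeClassJ N n) (sizeClass2 N) ⟩
  139 * (sizeClassJ N n * sizeClass2 N) ∎
  where
  open ≤-Reasoning
  bad : Map N → ℕ
  bad α = countMaps (λ β → inClassJ N n α ∧ disconnecting α β)
  by-class : ∀ α → indicator (inClassJ N n α) * countMaps (disconnecting α) * h
                     ≤ indicator (inClassJ N n α) * (139 * sizeClass2 N)
  by-class α with inClassJ N n α in α∈𝒞J
  ... | false = z≤n
  ... | true  = begin
    (countMaps (disconnecting α) + 0) * h
      ≡⟨ trans (cong (_* h) (+-identityʳ (countMaps (disconnecting α)))) (*-comm (countMaps (disconnecting α)) h) ⟩
    h * countMaps (disconnecting α)
      ≤⟨ h*disconnecting≤ 0<N ⟩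
    139 * sizeClass2 N
      ≡⟨ +-identityʳ _ ⟨
    1 * (139 * sizeClass2 N) ∎
    where
    open ClassJ n no-short-cycles α α∈𝒞J
    open Disconnection h N≡2h α α-injective α-no-fixed-point α-no-2-cycle
  per-α : ∀ α → bad α * h ≤ indicator (inClassJ N n α) * (139 * sizeClass2 N)
  per-α α = ≤-trans (≤-reflexive (cong (_* h) (countMaps-∧ (inClassJ N n α) (disconnecting α)))) (by-class α)

theorem4p1 : Σ ℕ (λ C → (0 < C) ×
               ((N : ℕ) (n : ℕ → ℕ) →
                N % 2 ≡ 0 →
                ((j : ℕ) → j < 3 → n j ≡ 0) →
                ((j : ℕ) → N < j → n j ≡ 0) →
                weightSum N n ≡ N →
                badPairs N n * N ≤ C * (sizeClassJ N n * sizeClass2 N)))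
theorem4p1 = 278 , s≤s z≤n , bound
  where
  bound : (N : ℕ) (n : ℕ → ℕ) → N % 2 ≡ 0 → ((j : ℕ) → j < 3 → n j ≡ 0) →
          ((j : ℕ) → N < j → n j ≡ 0) →
          weightSum N n ≡ N → badPairs N n * N ≤ 278 * (sizeClassJ N n * sizeClass2 N)
  bound zero        n _    _               _ _ = ≤-trans (≤-reflexive (*-zeroʳ (badPairs 0 n))) z≤n
  bound N@(suc _) n even no-short-cycles _ _ = begin
    badPairs N n * N
      ≡⟨ cong (badPairs N n *_) N≡2h ⟩
    badPairs N n * (2 * h)
      ≡⟨ solve 2 (λ b h → b :* (con 2 :* h) := con 2 :* (h :* b)) refl (badPairs N n) h ⟩
    2 * (h * badPairs N n)
      ≤⟨ *-monoʳ-≤ 2 (h*badPairs≤ N n h N≡2h (s≤s z≤n) no-short-cycles) ⟩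
    2 * (139 * (sizeClassJ N n * sizeClass2 N)) ≡⟨ *-assoc 2 139 (sizeClassJ N n * sizeClass2 N) ⟨
    278 * (sizeClassJ N n * sizeClass2 N) ∎
    where
    open ≤-Reasoning
    h = N / 2
    N≡2h : N ≡ 2 * h
    N≡2h = trans (m≡m%n+[m/n]*n N 2) (trans (cong (_+ h * 2) even) (*-comm h 2))
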